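{- Let $G$ be a graph of order $n\geq 3$ with $E(G)\neq\emptyset$. Then $h(G)=2$ if and only if either $G=K_3\cup\overline{K_{n-3}}$ or $G$ is a (possibly disconnected) subgraph of a double star.
   Context: All graphs are finite, undirected and simple. For $S\subseteq V(G)$ let $N^*(S)=\{x\in V(G)\setminus S : S\subseteq N_G(x)\}$, and let $i(N^*(S))$ be the number of vertices $v\in V(G)\setminus S$ with $v\in N^*(S)$ such that $v$ is an isolated vertex of $G-S$. Define $h(G)=\min\{|S|+|E(G-S)|+i(N^*(S)) : \emptyset\neq S\subseteq V(G)\}$. A double star is a tree with at least $4$ vertices and diameter exactly $3$. $K_3\cup\overline{K_{n-3}}$ is the disjoint union of a triangle and $n-3$ isolated vertices. -}

module Defs where

open import Data.Nat using (ℕ; zero; suc; _+_; _≤_; _<ᵇ_)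
open import Data.Bool using (Bool; true; false; _∧_; _∨_; not; if_then_else_)
open import Data.Fin using (Fin; toℕ; inject₁; fromℕ) renaming (zero to fzero; suc to fsuc)
import Data.Fin as Fin
open import Data.List using (List; map; allFin)
open import Data.Nat.ListAction using (sum)
open import Data.Bool.ListAction using (all)
open import Data.Product using (Σ; ∃; ∃-syntax; _×_; _,_)
open import Relation.Binary.PropositionalEquality using (_≡_)
open import Relation.Nullary using (¬_)
open import Relation.Nullary.Decidable using (⌊_⌋)
open import Function.Bundles using (_↔_; Inverse)
open import Function.Definitions using (Injective)

record Graph (n : ℕ) : Set where
  field
    adj    : Fin n → Fin n → Bool
    sym    : ∀ u v → adj u v ≡ adj v u
    irrefl : ∀ u → adj u u ≡ false
open Graph public

count : ∀ {n} → (Fin n → Bool) → ℕ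
count {n} p = sum (map (λ v → if p v then 1 else 0) (allFin n))

allV : ∀ {n} → (Fin n → Bool) → Bool
allV {n} p = all p (allFin n)

VSubset : ℕ → Set
VSubset n = Fin n → Bool

NonEmpty : ∀ {n} → VSubset n → Set
NonEmpty S = ∃[ v ] S v ≡ true

-- |E(G - S)| : unordered pairs {u,v} (u < v) outside S that are adjacent
edgesOutside : ∀ {n} → Graph n → VSubset n → ℕ
edgesOutside G S =
  sum (map (λ u → count (λ v → (toℕ u <ᵇ toℕ v) ∧ not (S u) ∧ not (S v) ∧ adj G u v))
           (allFin _))

inNstar : ∀ {n} → Graph n → VSubset n → Fin n → Bool
inNstar G S x = not (S x) ∧ allV (λ y → not (S y) ∨ adj G x y)

isolatedIn : ∀ {n} → Graph n → VSubset n → Fin n → Bool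
isolatedIn G S v = not (S v) ∧ allV (λ y → S y ∨ not (adj G v y))

iNstar : ∀ {n} → Graph n → VSubset n → ℕ
iNstar G S = count (λ v → inNstar G S v ∧ isolatedIn G S v)

hValue : ∀ {n} → Graph n → VSubset n → ℕ
hValue G S = count S + edgesOutside G S + iNstar G S

HEq : ∀ {n} → Graph n → ℕ → Set
HEq {n} G k =
  (∃[ S ] (NonEmpty S × hValue G S ≡ k)) ×
  (∀ (S : VSubset n) → NonEmpty S → k ≤ hValue G S)

IsoAdj : ∀ {n m} → (Fin n → Fin n → Bool) → (Fin m → Fin m → Bool) → Set
IsoAdj {n} {m} a b =
  Σ (Fin n ↔ Fin m) λ π → ∀ u v → a u v ≡ b (Inverse.to π u) (Inverse.to π v)

K3∪Empty : ∀ n → Fin n → Fin n → Bool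
K3∪Empty n u v = (toℕ u <ᵇ 3) ∧ (toℕ v <ᵇ 3) ∧ not ⌊ u Fin.≟ v ⌋

data Walk {n} (G : Graph n) : ℕ → Fin n → Fin n → Set where
  here : ∀ {u} → Walk G 0 u u
  step : ∀ {k u w v} → adj G u w ≡ true → Walk G k w v → Walk G (suc k) u v

DistLe : ∀ {n} → Graph n → ℕ → Fin n → Fin n → Set
DistLe G k u v = ∃[ j ] (j ≤ k × Walk G j u v)

Connected : ∀ {n} → Graph n → Set
Connected {n} G = ∀ (u v : Fin n) → ∃[ k ] Walk G k u v

HasCycle : ∀ {n} → Graph n → Set
HasCycle {n} G =
  ∃[ k ] Σ (Fin (suc (suc (suc k))) → Fin n) λ c →
    Injective _≡_ _≡_ c ×
    (∀ (i : Fin (suc (suc k))) → adj G (c (inject₁ i)) (c (fsuc i)) ≡ true) ×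
    adj G (c (fromℕ (suc (suc k)))) (c fzero) ≡ true

IsTree : ∀ {n} → Graph n → Set
IsTree G = Connected G × ¬ HasCycle G

Diameter3 : ∀ {n} → Graph n → Set
Diameter3 {n} G =
  (∀ (u v : Fin n) → DistLe G 3 u v) × (∃[ u ] ∃[ v ] ¬ DistLe G 2 u v)

IsDoubleStar : ∀ {m} → Graph m → Set
IsDoubleStar {m} D = 4 ≤ m × IsTree D × Diameter3 D

SubgraphOfDoubleStar : ∀ {n} → Graph n → Set
SubgraphOfDoubleStar {n} G =
  ∃[ m ] Σ (Graph m) λ D → IsDoubleStar D ×
    Σ (Fin n → Fin m) λ f → Injective _≡_ _≡_ f ×
      (∀ u v → adj G u v ≡ true → adj D (f u) (f v) ≡ true)

{-# OPTIONS --safe #-}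
-- If G has an edge, every nonempty S has hValue ≥ 2: when S = {w}, either some edge avoids w, or a
-- neighbour of w has an edge outside S, or that neighbour is an isolated vertex of G − S in N*(S).
-- If S attains 2, then either |S| = 2, no edge avoids S and i(N*(S)) = 0, which says precisely that
-- the two vertices of S are the centres of a double star containing G; or S = {a} and G − a has at
-- most one edge. With no edge G is a star at a; with one edge xy, i(N*(S)) = 0 forces every
-- neighbour of a onto xy, so G is the triangle axy or a double star centred at an end of xy.
-- Conversely a triangle is realised by S = {x} and a double star by its two centres. The centres
-- of a double star are the middle edge of a path of length 3: in an acyclic graph all
-- non-backtracking walks between two vertices have the same length, so with diameter 3 every
-- vertex is within distance 1 of that edge and every edge meets it.
module Submission where

open import Defs
import Data.Nat
open import Data.Nat using (ℕ; zero; suc; _+_; _≤_; _<_; _<ᵇ_; z≤n; s≤s)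
open import Data.Nat.Properties
  using (≤-refl; ≤-trans; m≤m+n; m≤n+m; +-mono-≤; +-monoʳ-≤; +-identityʳ; +-assoc; +-commutativeSemigroup;
         1+n≰n; 1+n≢0; <-cmp; <-asym; <ᵇ⇒<; <⇒<ᵇ; n≤1+n)
open import Data.Bool using (Bool; true; false; _∧_; _∨_; not; if_then_else_)
open import Data.Bool.Properties using (∧-conicalˡ; ∧-conicalʳ; ∧-zeroʳ; ∧-identityʳ; not-injective; ¬-not; T-≡)
open import Data.Fin using (Fin; toℕ; inject₁; fromℕ) renaming (zero to fzero; suc to fsuc)
open import Data.Fin.Properties using (_≟_; any?; toℕ-injective; suc-injective)
open import Data.List using (List; []; _∷_; _++_; _ʳ++_; length; map; allFin)
import Data.List as List
open import Data.Maybe using (just)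
open import Data.List.Relation.Unary.Linked using (Linked; []; [-]; _∷_; _∷′_)
import Data.List.Relation.Unary.Linked as Linked
open import Data.Maybe.Relation.Binary.Connected
  using (just; just-nothing; nothing-just) renaming (Connected to MaybeConnected; sym to MaybeConnected-sym)
open import Data.List.Properties using (map-tabulate; ++-assoc)
open import Data.List.Relation.Unary.All using (All; []; _∷_)
import Data.List.Relation.Unary.All as All
open import Data.List.Relation.Unary.AllPairs using ([]; _∷_)
open import Data.List.Relation.Unary.Unique.Propositional using (Unique)
open import Data.List.Membership.Propositional using (_∈_; _∉_)
open import Data.List.Relation.Unary.Any using (here; there)
open import Data.List.Relation.Unary.All.Properties using (all⁺; all⁻; tabulate⁺; ++⁻ˡ; ¬Any⇒All¬)
open import Data.List.Membership.Propositional.Properties using (∈-allFin; ∈-lookup; ∈-++⁺ʳ; ∈-∃++)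
open import Data.Nat.ListAction using (sum)
open import Data.Product using (Σ; ∃-syntax; _×_; _,_; proj₁; proj₂)
open import Data.Sum using (_⊎_; inj₁; inj₂; [_,_]′)
import Data.Sum
open import Data.Empty using (⊥; ⊥-elim)
open import Relation.Binary.PropositionalEquality
  using (_≡_; _≢_; refl; trans; cong; cong₂; subst; subst₂; module ≡-Reasoning)
  renaming (sym to ≡-sym)
open import Relation.Nullary using (¬_; Dec; yes; no; does)
open import Relation.Nullary.Decidable using (⌊_⌋; ¬?; _×-dec_; _⊎-dec_; decidable-stable)
open import Function using (_∘_)
open import Function.Bundles using (Equivalence; Injection; _⇔_; mk⇔)
open import Function.Properties.Inverse using (↔⇒↣)
open import Function.Definitions using (Injective)
open import Data.Fin.Permutation using (Permutation; transpose; _∘ₚ_; _⟨$⟩ʳ_; _⟨$⟩ˡ_; inverseʳ)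
import Data.Fin.Permutation.Components as PC
open import Function.Properties.Equivalence using () renaming (refl to ⇔-refl; sym to ⇔-sym; trans to ⇔-trans)
open import Relation.Binary using (tri<; tri≈; tri>)
open import Algebra.Properties.CommutativeSemigroup +-commutativeSemigroup using (x∙yz≈y∙xz)

∧-intro : ∀ {a b} → a ≡ true → b ≡ true → a ∧ b ≡ true
∧-intro refl refl = refl

∨-elim : ∀ {a b} → a ∨ b ≡ true → a ≡ true ⊎ b ≡ true
∨-elim {true} _ = inj₁ refl
∨-elim {false} e = inj₂ e

true≢false : ∀ {a} → a ≡ true → a ≢ false
true≢false refl ()

-- Sums and counts over Fin n

-- count p and edgesOutside G S (from Defs) are definitionally sums of this form.
sumFin : ∀ {n} → (Fin n → ℕ) → ℕ
sumFin {n} g = sum (map g (allFin n))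

indicator : Bool → ℕ
indicator b = if b then 1 else 0

sumFin-suc : ∀ {n} (g : Fin (suc n) → ℕ) → sumFin g ≡ g fzero + sumFin (g ∘ fsuc)
sumFin-suc g = cong (g fzero +_) (cong sum (trans (map-tabulate fsuc g) (≡-sym (map-tabulate (λ i → i) (g ∘ fsuc)))))

sumFin-cong : ∀ {n} {g h : Fin n → ℕ} → (∀ i → g i ≡ h i) → sumFin g ≡ sumFin h
sumFin-cong {zero} _ = refl
sumFin-cong {suc n} {g} {h} g≗h = begin
  sumFin g                   ≡⟨ sumFin-suc g ⟩
  g fzero + sumFin (g ∘ fsuc) ≡⟨ cong₂ _+_ (g≗h fzero) (sumFin-cong (g≗h ∘ fsuc)) ⟩
  h fzero + sumFin (h ∘ fsuc) ≡⟨ ≡-sym (sumFin-suc h) ⟩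
  sumFin h                   ∎
  where open ≡-Reasoning

sumFin-zero : ∀ {n} (g : Fin n → ℕ) → (∀ i → g i ≡ 0) → sumFin g ≡ 0
sumFin-zero {zero} g _ = refl
sumFin-zero {suc n} g g≗0 = trans (sumFin-suc g) (cong₂ _+_ (g≗0 fzero) (sumFin-zero (g ∘ fsuc) (g≗0 ∘ fsuc)))

sumFin-nonzero : ∀ {n} (g : Fin n → ℕ) → sumFin g ≢ 0 → ∃[ i ] g i ≢ 0
sumFin-nonzero {zero} g s≢0 = ⊥-elim (s≢0 refl)
sumFin-nonzero {suc n} g s≢0 with g fzero Data.Nat.≟ 0
... | no g0≢0 = fzero , g0≢0
... | yes g0≡0 with sumFin-nonzero (g ∘ fsuc) (λ s≡0 → s≢0 (trans (sumFin-suc g) (cong₂ _+_ g0≡0 s≡0)))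
...   | i , gi≢0 = fsuc i , gi≢0

erase : ∀ {n} → Fin n → (Fin n → ℕ) → Fin n → ℕ
erase i g j = if does (j ≟ i) then 0 else g j

sumFin-erase : ∀ {n} (g : Fin n → ℕ) i → sumFin g ≡ g i + sumFin (erase i g)
sumFin-erase g fzero = trans (sumFin-suc g) (cong (g fzero +_) (≡-sym (sumFin-suc (erase fzero g))))
sumFin-erase g (fsuc i) = begin
  sumFin g                                                ≡⟨ sumFin-suc g ⟩
  g fzero + sumFin (g ∘ fsuc)                             ≡⟨ cong (g fzero +_) (sumFin-erase (g ∘ fsuc) i) ⟩
  g fzero + (g (fsuc i) + sumFin (erase i (g ∘ fsuc)))    ≡⟨ x∙yz≈y∙xz (g fzero) (g (fsuc i)) _ ⟩
  g (fsuc i) + (g fzero + sumFin (erase i (g ∘ fsuc)))    ≡⟨ cong (g (fsuc i) +_) (≡-sym (sumFin-suc (erase (fsuc i) g))) ⟩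
  g (fsuc i) + sumFin (erase (fsuc i) g)                  ∎
  where open ≡-Reasoning

point≤sumFin : ∀ {n} (g : Fin n → ℕ) i → g i ≤ sumFin g
point≤sumFin g i = subst (g i ≤_) (≡-sym (sumFin-erase g i)) (m≤m+n (g i) _)

twoPoints≤sumFin : ∀ {n} (g : Fin n → ℕ) {i j} → i ≢ j → g i + g j ≤ sumFin g
twoPoints≤sumFin g {i} {j} i≢j = subst (g i + g j ≤_) (≡-sym (sumFin-erase g i))
  (+-monoʳ-≤ (g i) (subst (_≤ sumFin (erase i g)) erase-j (point≤sumFin (erase i g) j)))
  where
  erase-j : erase i g j ≡ g j
  erase-j with j ≟ i
  ... | yes j≡i = ⊥-elim (i≢j (≡-sym j≡i))
  ... | no _ = refl

sumFin-single : ∀ {n} (g : Fin n → ℕ) i → (∀ j → j ≢ i → g j ≡ 0) → sumFin g ≡ g i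
sumFin-single g i others = trans (sumFin-erase g i) (trans (cong (g i +_) (sumFin-zero (erase i g) erased)) (+-identityʳ (g i)))
  where
  erased : ∀ j → erase i g j ≡ 0
  erased j with j ≟ i
  ... | yes _ = refl
  ... | no j≢i = others j j≢i

_∖_ : ∀ {n} → (Fin n → Bool) → Fin n → Fin n → Bool
(p ∖ v) w = p w ∧ not (does (w ≟ v))

∖-true : ∀ {n} (p : Fin n → Bool) {v w} → p w ≡ true → w ≢ v → (p ∖ v) w ≡ true
∖-true p {v} {w} pw w≢v with w ≟ v
... | yes w≡v = ⊥-elim (w≢v w≡v)
... | no _ = trans (∧-identityʳ _) pw

∖-elim : ∀ {n} (p : Fin n → Bool) {v w} → (p ∖ v) w ≡ true → p w ≡ true × w ≢ v
∖-elim p {v} {w} e with w ≟ v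
... | yes _ = ⊥-elim (true≢false e (∧-zeroʳ (p w)))
... | no w≢v = trans (≡-sym (∧-identityʳ (p w))) e , w≢v

∖-all : ∀ {n} (p : Fin n → Bool) {x xs} → All (λ v → p v ≡ true) xs → All (x ≢_) xs → All (λ v → (p ∖ x) v ≡ true) xs
∖-all p pxs x≢xs = All.zipWith (λ (py , x≢y) → ∖-true p py (x≢y ∘ ≡-sym)) (pxs , x≢xs)

count-∖ : ∀ {n} {p : Fin n → Bool} {v} → p v ≡ true → count p ≡ suc (count (p ∖ v))
count-∖ {p = p} {v} pv = trans (sumFin-erase _ v) (cong₂ _+_ (cong indicator pv) (sumFin-cong erased))
  where
  erased : ∀ w → erase v (indicator ∘ p) w ≡ indicator ((p ∖ v) w)
  erased w with w ≟ v
  ... | yes _ = cong indicator (≡-sym (∧-zeroʳ (p w)))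
  ... | no _ = cong indicator (≡-sym (∧-identityʳ (p w)))

count-zero : ∀ {n} (p : Fin n → Bool) → (∀ v → p v ≡ false) → count p ≡ 0
count-zero p p≗false = sumFin-zero _ (λ v → cong indicator (p≗false v))

count-nonzero : ∀ {n} (p : Fin n → Bool) → count p ≢ 0 → ∃[ v ] p v ≡ true
count-nonzero p c≢0 with sumFin-nonzero _ c≢0
... | v , pv≢0 with p v in pv
...   | true = v , pv
...   | false = ⊥-elim (pv≢0 refl)

length≤count : ∀ {n} {p : Fin n → Bool} {xs} → All (λ v → p v ≡ true) xs → Unique xs → length xs ≤ count p
length≤count [] [] = z≤n
length≤count {p = p} {x ∷ xs} (px ∷ pxs) (x≢xs ∷ unique) =
  subst (suc (length xs) ≤_) (≡-sym (count-∖ {p = p} px)) (s≤s (length≤count {p = p ∖ x} (∖-all p pxs x≢xs) unique))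

count-pos : ∀ {n} (p : Fin n → Bool) v → p v ≡ true → 1 ≤ count p
count-pos p v pv = length≤count {p = p} {xs = v ∷ []} (pv ∷ []) ([] ∷ [])

count≡length : ∀ {n} {p : Fin n → Bool} {xs} → All (λ v → p v ≡ true) xs → Unique xs →
  (∀ v → p v ≡ true → v ∈ xs) → count p ≡ length xs
count≡length {p = p} [] [] only = count-zero p (λ v → ¬-not (λ pv → noMember (only v pv)))
  where
  noMember : ∀ {v} → v ∉ []
  noMember ()
count≡length {p = p} {x ∷ xs} (px ∷ pxs) (x≢xs ∷ unique) only =
  trans (count-∖ {p = p} px) (cong suc (count≡length {p = p ∖ x} (∖-all p pxs x≢xs) unique only′))
  where
  only′ : ∀ v → (p ∖ x) v ≡ true → v ∈ xs
  only′ v e with ∖-elim p e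
  ... | pv , v≢x with only v pv
  ...   | here v≡x = ⊥-elim (v≢x v≡x)
  ...   | there v∈xs = v∈xs

-- The three terms of hValue

adj-sym : ∀ {n} (G : Graph n) {u v} → adj G u v ≡ true → adj G v u ≡ true
adj-sym G {u} {v} e = trans (Graph.sym G v u) e

adj⇒≢ : ∀ {n} (G : Graph n) {u v} → adj G u v ≡ true → u ≢ v
adj⇒≢ G {u} e refl = true≢false e (irrefl G u)

record OutsideEdge {n} (G : Graph n) (S : VSubset n) (u v : Fin n) : Set where
  constructor outsideEdge
  field
    adjacent : adj G u v ≡ true
    u∉S      : S u ≡ false
    v∉S      : S v ≡ false

OutsideEdge-sym : ∀ {n} {G : Graph n} {S u v} → OutsideEdge G S u v → OutsideEdge G S v u
OutsideEdge-sym {G = G} (outsideEdge uv u∉S v∉S) = outsideEdge (adj-sym G uv) v∉S u∉S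

SameEdge : ∀ {n} → Fin n → Fin n → Fin n → Fin n → Set
SameEdge u v x y = (u ≡ x × v ≡ y) ⊎ (u ≡ y × v ≡ x)

SameEdge-sym : ∀ {n} {u v x y : Fin n} → SameEdge u v x y → SameEdge x y u v
SameEdge-sym (inj₁ (refl , refl)) = inj₁ (refl , refl)
SameEdge-sym (inj₂ (refl , refl)) = inj₂ (refl , refl)

SameEdge-trans : ∀ {n} {u v x y s t : Fin n} → SameEdge u v x y → SameEdge x y s t → SameEdge u v s t
SameEdge-trans (inj₁ (refl , refl)) same = same
SameEdge-trans (inj₂ (refl , refl)) (inj₁ (refl , refl)) = inj₂ (refl , refl)
SameEdge-trans (inj₂ (refl , refl)) (inj₂ (refl , refl)) = inj₁ (refl , refl)

-- The summand of edgesOutside: each edge outside S is counted once, from its endpoint of smaller index.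
orientedEdge : ∀ {n} → Graph n → VSubset n → Fin n → Fin n → Bool
orientedEdge G S u v = (toℕ u <ᵇ toℕ v) ∧ not (S u) ∧ not (S v) ∧ adj G u v

orientedEdge-intro : ∀ {n} {G : Graph n} {S u v} → toℕ u < toℕ v → OutsideEdge G S u v → orientedEdge G S u v ≡ true
orientedEdge-intro u<v (outsideEdge uv u∉S v∉S) =
  ∧-intro (Equivalence.to T-≡ (<⇒<ᵇ u<v)) (∧-intro (cong not u∉S) (∧-intro (cong not v∉S) uv))

orientedEdge-elim : ∀ {n} (G : Graph n) S u v → orientedEdge G S u v ≡ true → toℕ u < toℕ v × OutsideEdge G S u v
orientedEdge-elim G S u v e =
  <ᵇ⇒< (toℕ u) (toℕ v) (Equivalence.from T-≡ (∧-conicalˡ (toℕ u <ᵇ toℕ v) _ e)) ,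
  outsideEdge (∧-conicalʳ (not (S v)) _ e₂) (not-injective (∧-conicalˡ (not (S u)) _ e₁))
              (not-injective (∧-conicalˡ (not (S v)) _ e₂))
  where
  e₁ : not (S u) ∧ not (S v) ∧ adj G u v ≡ true
  e₁ = ∧-conicalʳ (toℕ u <ᵇ toℕ v) _ e
  e₂ : not (S v) ∧ adj G u v ≡ true
  e₂ = ∧-conicalʳ (not (S u)) _ e₁

orient : ∀ {n} {G : Graph n} {S u v} → OutsideEdge G S u v →
  ∃[ s ] ∃[ t ] orientedEdge G S s t ≡ true × SameEdge u v s t
orient {G = G} {u = u} {v} out with <-cmp (toℕ u) (toℕ v)
... | tri< u<v _ _ = u , v , orientedEdge-intro u<v out , inj₁ (refl , refl)
... | tri≈ _ u≡v _ = ⊥-elim (adj⇒≢ G (OutsideEdge.adjacent out) (toℕ-injective u≡v))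
... | tri> _ _ v<u = v , u , orientedEdge-intro v<u (OutsideEdge-sym out) , inj₂ (refl , refl)

oriented-unique : ∀ {n} {G : Graph n} {S s t u w} → orientedEdge G S s t ≡ true → orientedEdge G S u w ≡ true →
  SameEdge u w s t → u ≡ s × w ≡ t
oriented-unique st uw (inj₁ same) = same
oriented-unique {G = G} {S} {s} {t} st uw (inj₂ (refl , refl)) =
  ⊥-elim (<-asym (proj₁ (orientedEdge-elim G S s t st)) (proj₁ (orientedEdge-elim G S t s uw)))

edgesOutside-pos : ∀ {n} {G : Graph n} {S u v} → OutsideEdge G S u v → 1 ≤ edgesOutside G S
edgesOutside-pos {G = G} {S} out with orient out
... | s , t , st , _ = ≤-trans (count-pos (orientedEdge G S s) t st) (point≤sumFin (λ u → count (orientedEdge G S u)) s)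

edgesOutside-≥2 : ∀ {n} {G : Graph n} {S u v x y} → OutsideEdge G S u v → OutsideEdge G S x y →
  ¬ SameEdge u v x y → 2 ≤ edgesOutside G S
edgesOutside-≥2 {G = G} {S} out₁ out₂ different with orient out₁ | orient out₂
... | s , t , st , same₁ | s′ , t′ , st′ , same₂ with s ≟ s′
...   | yes refl = ≤-trans (length≤count (st ∷ st′ ∷ []) ((t≢t′ ∷ []) ∷ [] ∷ []))
                           (point≤sumFin (λ u → count (orientedEdge G S u)) s)
  where
  t≢t′ : t ≢ t′
  t≢t′ refl = different (SameEdge-trans same₁ (SameEdge-sym same₂))
...   | no s≢s′ = ≤-trans (+-mono-≤ (count-pos (orientedEdge G S s) t st) (count-pos (orientedEdge G S s′) t′ st′))
                          (twoPoints≤sumFin (λ u → count (orientedEdge G S u)) s≢s′)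

edgesOutside-zero : ∀ {n} (G : Graph n) S → (∀ u v → ¬ OutsideEdge G S u v) → edgesOutside G S ≡ 0
edgesOutside-zero G S none =
  sumFin-zero _ (λ u → count-zero _ (λ v → ¬-not (λ e → none u v (proj₂ (orientedEdge-elim G S u v e)))))

edgesOutside-nonzero : ∀ {n} (G : Graph n) S → edgesOutside G S ≢ 0 → ∃[ u ] ∃[ v ] OutsideEdge G S u v
edgesOutside-nonzero G S e≢0 with sumFin-nonzero _ e≢0
... | u , count≢0 with count-nonzero _ count≢0
...   | v , uv = u , v , proj₂ (orientedEdge-elim G S u v uv)

edgesOutside-one : ∀ {n} {G : Graph n} {S x y} → OutsideEdge G S x y →
  (∀ u v → OutsideEdge G S u v → SameEdge u v x y) → edgesOutside G S ≡ 1
edgesOutside-one {G = G} {S} out only with orient out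
... | s , t , st , same =
  trans (sumFin-single _ s (λ u u≢s → count-zero (orientedEdge G S u)
                                        (λ w → ¬-not (λ uw → u≢s (proj₁ (unique {u} {w} uw))))))
        (count≡length (st ∷ []) ([] ∷ []) (λ w sw → here (proj₂ (unique sw))))
  where
  unique : ∀ {u w} → orientedEdge G S u w ≡ true → u ≡ s × w ≡ t
  unique {u} {w} uw = oriented-unique {G = G} {S} st uw (SameEdge-trans (only u w (proj₂ (orientedEdge-elim G S u w uw))) same)

SameEdge? : ∀ {n} (u v x y : Fin n) → Dec (SameEdge u v x y)
SameEdge? u v x y = (u ≟ x ×-dec v ≟ y) ⊎-dec (u ≟ y ×-dec v ≟ x)

edgesOutside≡1 : ∀ {n} (G : Graph n) S → edgesOutside G S ≡ 1 →
  ∃[ x ] ∃[ y ] OutsideEdge G S x y × (∀ u v → OutsideEdge G S u v → SameEdge u v x y)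
edgesOutside≡1 G S e≡1 with edgesOutside-nonzero G S (λ e≡0 → 1+n≢0 (trans (≡-sym e≡1) e≡0))
... | x , y , out = x , y , out , only
  where
  only : ∀ u v → OutsideEdge G S u v → SameEdge u v x y
  only u v out′ with SameEdge? u v x y
  ... | yes same = same
  ... | no different = ⊥-elim (1+n≰n (subst (2 ≤_) e≡1 (edgesOutside-≥2 out′ out different)))

edgesOutside≡0⇒cover : ∀ {n} (G : Graph n) S → edgesOutside G S ≡ 0 →
  ∀ {u v} → adj G u v ≡ true → S u ≡ true ⊎ S v ≡ true
edgesOutside≡0⇒cover G S e≡0 {u} {v} uv with S u in Su | S v in Sv
... | true | _ = inj₁ refl
... | false | true = inj₂ refl
... | false | false = ⊥-elim (1+n≰n (subst (1 ≤_) e≡0 (edgesOutside-pos {G = G} {S} (outsideEdge uv Su Sv))))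

allV-intro : ∀ {n} (p : Fin n → Bool) → (∀ v → p v ≡ true) → allV p ≡ true
allV-intro p all-true = Equivalence.to T-≡ (all⁻ p (tabulate⁺ (λ v → Equivalence.from T-≡ (all-true v))))

allV-elim : ∀ {n} (p : Fin n → Bool) → allV p ≡ true → ∀ v → p v ≡ true
allV-elim p e v = Equivalence.to T-≡ (All.lookup (all⁺ p _ (Equivalence.from T-≡ e)) (∈-allFin v))

record IsolatedInNstar {n} (G : Graph n) (S : VSubset n) (x : Fin n) : Set where
  field
    outside    : S x ≡ false
    adjacentTo : ∀ {y} → S y ≡ true → adj G x y ≡ true
    isolated   : ∀ {y} → ¬ OutsideEdge G S x y

IsolatedInNstar-intro : ∀ {n} {G : Graph n} {S x} → IsolatedInNstar G S x → inNstar G S x ∧ isolatedIn G S x ≡ true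
IsolatedInNstar-intro {G = G} {S} {x} i =
  ∧-intro (∧-intro (cong not outside) (allV-intro _ inN)) (∧-intro (cong not outside) (allV-intro _ iso))
  where
  open IsolatedInNstar i
  inN : ∀ y → not (S y) ∨ adj G x y ≡ true
  inN y with S y in Sy
  ... | true = adjacentTo Sy
  ... | false = refl
  iso : ∀ y → S y ∨ not (adj G x y) ≡ true
  iso y with S y in Sy | adj G x y in xy
  ... | true | _ = refl
  ... | false | false = refl
  ... | false | true = ⊥-elim (isolated (outsideEdge xy outside Sy))

IsolatedInNstar-elim : ∀ {n} {G : Graph n} {S x} → inNstar G S x ∧ isolatedIn G S x ≡ true → IsolatedInNstar G S x
IsolatedInNstar-elim {G = G} {S} {x} e = record
  { outside = not-injective (∧-conicalˡ _ _ inN)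
  ; adjacentTo = λ {y} Sy → adjacent y Sy
  ; isolated = λ {y} (outsideEdge xy _ Sy) → apart y Sy xy }
  where
  inN = ∧-conicalˡ _ _ e
  iso = ∧-conicalʳ (inNstar G S x) _ e
  adjacent : ∀ y → S y ≡ true → adj G x y ≡ true
  adjacent y Sy with ∨-elim (allV-elim _ (∧-conicalʳ _ _ inN) y)
  ... | inj₁ notSy = ⊥-elim (true≢false Sy (not-injective notSy))
  ... | inj₂ xy = xy
  apart : ∀ y → S y ≡ false → adj G x y ≡ true → ⊥
  apart y Sy xy with ∨-elim (allV-elim (λ y → S y ∨ not (adj G x y)) (∧-conicalʳ (not (S x)) _ iso) y)
  ... | inj₁ Sy′ = true≢false Sy′ Sy
  ... | inj₂ notxy = true≢false xy (not-injective notxy)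

iNstar-pos : ∀ {n} {G : Graph n} {S x} → IsolatedInNstar G S x → 1 ≤ iNstar G S
iNstar-pos {x = x} i = count-pos _ x (IsolatedInNstar-intro i)

iNstar-zero : ∀ {n} (G : Graph n) S → (∀ x → ¬ IsolatedInNstar G S x) → iNstar G S ≡ 0
iNstar-zero G S none = count-zero _ (λ x → ¬-not (λ e → none x (IsolatedInNstar-elim e)))

iNstar≡0⇒¬isolated : ∀ {n} (G : Graph n) S {x} → iNstar G S ≡ 0 → ¬ IsolatedInNstar G S x
iNstar≡0⇒¬isolated G S i≡0 i = 1+n≰n (subst (1 ≤_) i≡0 (iNstar-pos i))

-- Graphs with h(G) = 2

_∈[_∣_] : ∀ {n} → Fin n → Fin n → Fin n → Set
u ∈[ a ∣ b ] = u ≡ a ⊎ u ≡ b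

-- The condition characterising the subgraphs of a double star with centres a and b.
record Centres {n} (G : Graph n) (a b : Fin n) : Set where
  field
    distinct          : a ≢ b
    cover             : ∀ {u v} → adj G u v ≡ true → u ∈[ a ∣ b ] ⊎ v ∈[ a ∣ b ]
    noCommonNeighbour : ∀ {x} → adj G x a ≡ true → adj G x b ≡ true → ⊥

star⇒Centres : ∀ {n} {G : Graph n} {p q} → q ≢ p → (∀ {u v} → adj G u v ≡ true → u ≡ p ⊎ v ≡ p) → Centres G p q
star⇒Centres {G = G} {p} {q} q≢p star = record
  { distinct = q≢p ∘ ≡-sym
  ; cover = λ uv → [ inj₁ ∘ inj₁ , inj₂ ∘ inj₁ ]′ (star uv)
  ; noCommonNeighbour = λ xp xq → [ adj⇒≢ G xp , q≢p ]′ (star xq) }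

_∈[_∣_∣_] : ∀ {n} → Fin n → Fin n → Fin n → Fin n → Set
u ∈[ x ∣ y ∣ z ] = u ≡ x ⊎ u ∈[ y ∣ z ]

-- A is K3∪Empty after relabelling 0, 1, 2 as x, y, z.
record Triangle {n} (A : Fin n → Fin n → Bool) (x y z : Fin n) : Set where
  field
    x≢y       : x ≢ y
    x≢z       : x ≢ z
    y≢z       : y ≢ z
    adjacent⇔ : ∀ {u v} → A u v ≡ true ⇔ (u ∈[ x ∣ y ∣ z ] × v ∈[ x ∣ y ∣ z ] × u ≢ v)

  edge : ∀ {u v} → u ∈[ x ∣ y ∣ z ] → v ∈[ x ∣ y ∣ z ] → u ≢ v → A u v ≡ true
  edge u∈ v∈ u≢v = Equivalence.from adjacent⇔ (u∈ , v∈ , u≢v)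

  within : ∀ {u v} → A u v ≡ true → u ∈[ x ∣ y ∣ z ]
  within uv = proj₁ (Equivalence.to adjacent⇔ uv)

Triangle-intro : ∀ {n} (G : Graph n) {x y z} → adj G x y ≡ true → adj G x z ≡ true → adj G y z ≡ true →
  (∀ {u v} → adj G u v ≡ true → u ∈[ x ∣ y ∣ z ]) → Triangle (adj G) x y z
Triangle-intro G {x} {y} {z} xy xz yz within = record
  { x≢y = adj⇒≢ G xy ; x≢z = adj⇒≢ G xz ; y≢z = adj⇒≢ G yz
  ; adjacent⇔ = mk⇔ (λ uv → within uv , within (adj-sym G uv) , adj⇒≢ G uv) (λ (u∈ , v∈ , u≢v) → edge u∈ v∈ u≢v) }
  where
  edge : ∀ {u v} → u ∈[ x ∣ y ∣ z ] → v ∈[ x ∣ y ∣ z ] → u ≢ v → adj G u v ≡ true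
  edge (inj₁ refl)        (inj₁ refl)        u≢v = ⊥-elim (u≢v refl)
  edge (inj₁ refl)        (inj₂ (inj₁ refl)) _   = xy
  edge (inj₁ refl)        (inj₂ (inj₂ refl)) _   = xz
  edge (inj₂ (inj₁ refl)) (inj₁ refl)        _   = adj-sym G xy
  edge (inj₂ (inj₁ refl)) (inj₂ (inj₁ refl)) u≢v = ⊥-elim (u≢v refl)
  edge (inj₂ (inj₁ refl)) (inj₂ (inj₂ refl)) _   = yz
  edge (inj₂ (inj₂ refl)) (inj₁ refl)        _   = adj-sym G xz
  edge (inj₂ (inj₂ refl)) (inj₂ (inj₁ refl)) _   = adj-sym G yz
  edge (inj₂ (inj₂ refl)) (inj₂ (inj₂ refl)) u≢v = ⊥-elim (u≢v refl)

singleton : ∀ {n} → Fin n → VSubset n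
singleton w v = does (v ≟ w)

doubleton : ∀ {n} → Fin n → Fin n → VSubset n
doubleton a b v = does (v ≟ a) ∨ does (v ≟ b)

singleton-self : ∀ {n} (w : Fin n) → singleton w w ≡ true
singleton-self w with w ≟ w
... | yes _ = refl
... | no w≢w = ⊥-elim (w≢w refl)

singleton-elim : ∀ {n} {w v : Fin n} → singleton w v ≡ true → v ≡ w
singleton-elim {w = w} {v} e with v ≟ w
... | yes v≡w = v≡w

≟-does-sym : ∀ {n} (x y : Fin n) → does (x ≟ y) ≡ does (y ≟ x)
≟-does-sym x y with x ≟ y | y ≟ x
... | yes _ | yes _ = refl
... | no _ | no _ = refl
... | yes x≡y | no y≢x = ⊥-elim (y≢x (≡-sym x≡y))
... | no x≢y | yes y≡x = ⊥-elim (x≢y (≡-sym y≡x))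

singleton-other : ∀ {n} {w v : Fin n} → v ≢ w → singleton w v ≡ false
singleton-other {w = w} {v} v≢w with v ≟ w
... | yes v≡w = ⊥-elim (v≢w v≡w)
... | no _ = refl

doubleton-intro : ∀ {n} {a b v : Fin n} → v ∈[ a ∣ b ] → doubleton a b v ≡ true
doubleton-intro {a = a} (inj₁ refl) rewrite singleton-self a = refl
doubleton-intro {a = a} {b} {v} (inj₂ refl) with v ≟ a
... | yes _ = refl
... | no _ = singleton-self v

doubleton-elim : ∀ {n} {a b v : Fin n} → doubleton a b v ≡ true → v ∈[ a ∣ b ]
doubleton-elim {a = a} {b} {v} e with v ≟ a | v ≟ b
... | yes v≡a | _ = inj₁ v≡a
... | no _ | yes v≡b = inj₂ v≡b

hValue-Centres : ∀ {n} (G : Graph n) {a b} → Centres G a b → hValue G (doubleton a b) ≡ 2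
hValue-Centres G {a} {b} c = cong₂ _+_ (cong₂ _+_ count-S edges-S) iNstar-S
  where
  open Centres c
  S = doubleton a b
  count-S : count S ≡ 2
  count-S = count≡length {p = S} (doubleton-intro {a = a} {b} (inj₁ refl) ∷ doubleton-intro {a = a} {b} (inj₂ refl) ∷ [])
    ((distinct ∷ []) ∷ [] ∷ []) (λ v Sv → [ here , there ∘ here ]′ (doubleton-elim Sv))
  edges-S : edgesOutside G S ≡ 0
  edges-S = edgesOutside-zero G S λ u v (outsideEdge uv Su Sv) →
    [ (λ u∈ → true≢false (doubleton-intro u∈) Su) , (λ v∈ → true≢false (doubleton-intro v∈) Sv) ]′ (cover uv)
  iNstar-S : iNstar G S ≡ 0
  iNstar-S = iNstar-zero G S λ x i → let open IsolatedInNstar i in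
    noCommonNeighbour (adjacentTo (doubleton-intro {a = a} {b} (inj₁ refl))) (adjacentTo (doubleton-intro {a = a} {b} (inj₂ refl)))

hValue-Triangle : ∀ {n} (G : Graph n) {x y z} → Triangle (adj G) x y z → hValue G (singleton x) ≡ 2
hValue-Triangle G {x} {y} {z} t = cong₂ _+_ (cong₂ _+_ count-S edges-S) iNstar-S
  where
  open Triangle t
  xy = edge (inj₁ refl) (inj₂ (inj₁ refl)) x≢y
  xz = edge (inj₁ refl) (inj₂ (inj₂ refl)) x≢z
  yz = edge (inj₂ (inj₁ refl)) (inj₂ (inj₂ refl)) y≢z
  S = singleton x
  count-S : count S ≡ 1
  count-S = count≡length {p = S} (singleton-self x ∷ []) ([] ∷ []) (λ v Sv → here (singleton-elim Sv))
  opposite : ∀ {u v} → adj G u v ≡ true → S u ≡ false → u ∈[ y ∣ z ]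
  opposite uv Su = [ (λ { refl → ⊥-elim (true≢false (singleton-self x) Su) }) , (λ u∈ → u∈) ]′ (within uv)
  yz-outside : OutsideEdge G S y z
  yz-outside = outsideEdge yz (singleton-other (adj⇒≢ G xy ∘ ≡-sym)) (singleton-other (adj⇒≢ G xz ∘ ≡-sym))
  edges-S : edgesOutside G S ≡ 1
  edges-S = edgesOutside-one yz-outside only
    where
    only : ∀ u v → OutsideEdge G S u v → SameEdge u v y z
    only u v (outsideEdge uv Su Sv) with opposite uv Su | opposite (adj-sym G uv) Sv
    ... | inj₁ refl | inj₁ refl = ⊥-elim (adj⇒≢ G uv refl)
    ... | inj₁ refl | inj₂ refl = inj₁ (refl , refl)
    ... | inj₂ refl | inj₁ refl = inj₂ (refl , refl)
    ... | inj₂ refl | inj₂ refl = ⊥-elim (adj⇒≢ G uv refl)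
  iNstar-S : iNstar G S ≡ 0
  iNstar-S = iNstar-zero G S λ v i → let open IsolatedInNstar i in
    [ (λ { refl → isolated yz-outside }) , (λ { refl → isolated (OutsideEdge-sym yz-outside) }) ]′
      (opposite (adjacentTo {x} (singleton-self x)) outside)

secondElement? : ∀ {n} (S : VSubset n) w → (∃[ b ] b ≢ w × S b ≡ true) ⊎ (∀ z → S z ≡ true → z ≡ w)
secondElement? S w with any? (λ b → ¬? (b ≟ w) ×-dec (S b Data.Bool.≟ true))
... | yes (b , b≢w , Sb) = inj₁ (b , b≢w , Sb)
... | no none = inj₂ (λ z Sz → decidable-stable (z ≟ w) (λ z≢w → none (z , z≢w , Sz)))

outsideSingleton : ∀ {n} {S : VSubset n} {w z} → (∀ z → S z ≡ true → z ≡ w) → z ≢ w → S z ≡ false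
outsideSingleton S⊆w z≢w = ¬-not (λ Sz → z≢w (S⊆w _ Sz))

neighbourOfSingleton : ∀ {n} {G : Graph n} {S w x} → (∀ z → S z ≡ true → z ≡ w) → adj G x w ≡ true →
  (∃[ y ] OutsideEdge G S x y) ⊎ IsolatedInNstar G S x
neighbourOfSingleton {G = G} {S} {w} {x} S⊆w xw with any? (λ y → (S y Data.Bool.≟ false) ×-dec (adj G x y Data.Bool.≟ true))
... | yes (y , Sy , xy) = inj₁ (y , outsideEdge xy Sx Sy)
  where Sx = outsideSingleton S⊆w (adj⇒≢ G xw)
... | no none = inj₂ (record
  { outside = outsideSingleton S⊆w (adj⇒≢ G xw)
  ; adjacentTo = λ Sy → subst (λ y → adj G x y ≡ true) (≡-sym (S⊆w _ Sy)) xw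
  ; isolated = λ (outsideEdge xy _ Sy) → none (_ , Sy , xy) })

hValue≥2 : ∀ {n} (G : Graph n) → (∃[ u ] ∃[ v ] adj G u v ≡ true) → ∀ S → NonEmpty S → 2 ≤ hValue G S
hValue≥2 G (u , v , uv) S (w , Sw) with secondElement? S w
... | inj₁ (b , b≢w , Sb) = ≤-trans (length≤count {p = S} {xs = b ∷ w ∷ []} (Sb ∷ Sw ∷ []) ((b≢w ∷ []) ∷ [] ∷ []))
                                   (≤-trans (m≤m+n _ _) (m≤m+n _ _))
... | inj₂ S⊆w = subst (2 ≤_) (≡-sym (+-assoc (count S) _ _)) (+-mono-≤ (count-pos S w Sw) edgesOrIsolated)
  where
  edgesOrIsolated : 1 ≤ edgesOutside G S + iNstar G S
  edgesOrIsolated with any? (λ x → adj G x w Data.Bool.≟ true)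
  ... | no w-isolated = ≤-trans (edgesOutside-pos {G = G} {S} (outsideEdge uv (avoids (v , adj-sym G uv)) (avoids (u , uv))))
                                (m≤m+n _ _)
    where
    avoids : ∀ {z} → ∃[ y ] adj G y z ≡ true → S z ≡ false
    avoids {z} (y , yz) = outsideSingleton S⊆w (λ { refl → w-isolated (y , yz) })
  ... | yes (x , xw) with neighbourOfSingleton {G = G} S⊆w xw
  ...   | inj₁ (_ , out) = ≤-trans (edgesOutside-pos out) (m≤m+n _ _)
  ...   | inj₂ i = ≤-trans (iNstar-pos i) (m≤n+m _ _)

sum≡2-first≥2 : ∀ a b c → a + b + c ≡ 2 → 2 ≤ a → b ≡ 0 × c ≡ 0
sum≡2-first≥2 2 0 0 _ _ = refl , refl
sum≡2-first≥2 2 0 (suc c) () _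
sum≡2-first≥2 2 (suc b) c () _
sum≡2-first≥2 (suc (suc (suc a))) b c () _
sum≡2-first≥2 1 b c _ (s≤s ())

sum≡2-first≡1 : ∀ b c → 1 + b + c ≡ 2 → b ≡ 0 ⊎ (b ≡ 1 × c ≡ 0)
sum≡2-first≡1 0 c _ = inj₁ refl
sum≡2-first≡1 1 0 _ = inj₂ (refl , refl)
sum≡2-first≡1 1 (suc c) ()
sum≡2-first≡1 (suc (suc b)) c ()

Shape : ∀ {n} → Graph n → Set
Shape G = (∃[ x ] ∃[ y ] ∃[ z ] Triangle (adj G) x y z) ⊎ (∃[ a ] ∃[ b ] Centres G a b)

hValue≡2-twoElements : ∀ {n} {G : Graph n} {S a b} → S a ≡ true → S b ≡ true → a ≢ b →
  hValue G S ≡ 2 → Centres G a b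
hValue≡2-twoElements {G = G} {S} {a} {b} Sa Sb a≢b h≡2 = record
  { distinct = a≢b
  ; cover = λ uv → [ inj₁ ∘ S⊆ab , inj₂ ∘ S⊆ab ]′ (edgesOutside≡0⇒cover G S e≡0 uv)
  ; noCommonNeighbour = λ xa xb → iNstar≡0⇒¬isolated G S i≡0 (commonNeighbour xa xb) }
  where
  two≤count : 2 ≤ count S
  two≤count = length≤count {p = S} {xs = a ∷ b ∷ []} (Sa ∷ Sb ∷ []) ((a≢b ∷ []) ∷ [] ∷ [])
  e≡0 : edgesOutside G S ≡ 0
  e≡0 = proj₁ (sum≡2-first≥2 (count S) (edgesOutside G S) (iNstar G S) h≡2 two≤count)
  i≡0 : iNstar G S ≡ 0
  i≡0 = proj₂ (sum≡2-first≥2 (count S) (edgesOutside G S) (iNstar G S) h≡2 two≤count)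
  count≤2 : count S ≤ 2
  count≤2 = subst (count S ≤_) h≡2 (≤-trans (m≤m+n (count S) _) (m≤m+n _ _))
  S⊆ab : ∀ {z} → S z ≡ true → z ∈[ a ∣ b ]
  S⊆ab {z} Sz with z ≟ a | z ≟ b
  ... | yes z≡a | _ = inj₁ z≡a
  ... | no _ | yes z≡b = inj₂ z≡b
  ... | no z≢a | no z≢b = ⊥-elim (1+n≰n (≤-trans three≤count count≤2))
    where
    three≤count : 3 ≤ count S
    three≤count = length≤count {p = S} {xs = a ∷ b ∷ z ∷ []} (Sa ∷ Sb ∷ Sz ∷ [])
      ((a≢b ∷ (z≢a ∘ ≡-sym) ∷ []) ∷ ((z≢b ∘ ≡-sym) ∷ []) ∷ [] ∷ [])
  commonNeighbour : ∀ {x} → adj G x a ≡ true → adj G x b ≡ true → IsolatedInNstar G S x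
  commonNeighbour {x} xa xb = record
    { outside = ¬-not λ Sx → [ adj⇒≢ G xa , adj⇒≢ G xb ]′ (S⊆ab Sx)
    ; adjacentTo = λ Sy → [ (λ { refl → xa }) , (λ { refl → xb }) ]′ (S⊆ab Sy)
    ; isolated = λ out → 1+n≰n (subst (1 ≤_) e≡0 (edgesOutside-pos out)) }

hValue≡2-noOutsideEdge : ∀ {n} {G : Graph n} {S a} → (∃[ u ] ∃[ v ] adj G u v ≡ true) →
  (∀ z → S z ≡ true → z ≡ a) → edgesOutside G S ≡ 0 → ∃[ x ] Centres G a x
hValue≡2-noOutsideEdge {G = G} {S} {a} (u , v , uv) S⊆a e≡0 = x , star⇒Centres (adj⇒≢ G ax ∘ ≡-sym) star
  where
  star : ∀ {u v} → adj G u v ≡ true → u ≡ a ⊎ v ≡ a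
  star uv = Data.Sum.map (S⊆a _) (S⊆a _) (edgesOutside≡0⇒cover G S e≡0 uv)
  neighbour : ∃[ x ] adj G a x ≡ true
  neighbour with star uv
  ... | inj₁ refl = v , uv
  ... | inj₂ refl = u , adj-sym G uv
  x = proj₁ neighbour
  ax = proj₂ neighbour

SameEdge-flip : ∀ {n} {u v x y : Fin n} → SameEdge u v x y → SameEdge u v y x
SameEdge-flip (inj₁ same) = inj₂ same
SameEdge-flip (inj₂ same) = inj₁ same

module OneOutsideEdge {n} {G : Graph n} {S : VSubset n} {a x y : Fin n}
  (S⊆a : ∀ z → S z ≡ true → z ≡ a) (Sa : S a ≡ true) (i≡0 : iNstar G S ≡ 0)
  (out : OutsideEdge G S x y) (only : ∀ u v → OutsideEdge G S u v → SameEdge u v x y) where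

  -- A neighbour of a off the edge xy would be an isolated vertex of G − S lying in N*(S).
  neighbours : ∀ {v} → adj G a v ≡ true → v ∈[ x ∣ y ]
  neighbours av with neighbourOfSingleton S⊆a (adj-sym G av)
  ... | inj₁ (_ , out′) = [ inj₁ ∘ proj₁ , inj₂ ∘ proj₁ ]′ (only _ _ out′)
  ... | inj₂ isolated = ⊥-elim (iNstar≡0⇒¬isolated G S i≡0 isolated)

  edges : ∀ {u v} → adj G u v ≡ true → u ≡ a ⊎ v ≡ a ⊎ SameEdge u v x y
  edges {u} {v} uv with S u in Su | S v in Sv
  ... | true | _ = inj₁ (S⊆a u Su)
  ... | false | true = inj₂ (inj₁ (S⊆a v Sv))
  ... | false | false = inj₂ (inj₂ (only u v (outsideEdge uv Su Sv)))

  a≢x : a ≢ x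
  a≢x refl = true≢false Sa (OutsideEdge.u∉S out)

  xy : adj G x y ≡ true
  xy = OutsideEdge.adjacent out

  triangle : adj G a x ≡ true → adj G a y ≡ true → Triangle (adj G) a x y
  triangle ax ay = Triangle-intro G ax ay xy within
    where
    within : ∀ {u v} → adj G u v ≡ true → u ∈[ a ∣ x ∣ y ]
    within uv with edges uv
    ... | inj₁ u≡a = inj₁ u≡a
    ... | inj₂ (inj₁ refl) = inj₂ (neighbours (adj-sym G uv))
    ... | inj₂ (inj₂ same) = inj₂ ([ inj₁ ∘ proj₁ , inj₂ ∘ proj₁ ]′ same)

  pendant : adj G a x ≡ true → adj G a y ≡ false → Centres G x a
  pendant ax ay = record { distinct = a≢x ∘ ≡-sym ; cover = cover ; noCommonNeighbour = noCommon }
    where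
    cover : ∀ {u v} → adj G u v ≡ true → u ∈[ x ∣ a ] ⊎ v ∈[ x ∣ a ]
    cover uv with edges uv
    ... | inj₁ u≡a = inj₁ (inj₂ u≡a)
    ... | inj₂ (inj₁ v≡a) = inj₂ (inj₂ v≡a)
    ... | inj₂ (inj₂ (inj₁ (u≡x , _))) = inj₁ (inj₁ u≡x)
    ... | inj₂ (inj₂ (inj₂ (_ , v≡x))) = inj₂ (inj₁ v≡x)
    noCommon : ∀ {z} → adj G z x ≡ true → adj G z a ≡ true → ⊥
    noCommon zx za with neighbours (adj-sym G za)
    ... | inj₁ refl = adj⇒≢ G zx refl
    ... | inj₂ refl = true≢false (adj-sym G za) ay

  apart : adj G a x ≡ false → adj G a y ≡ false → Centres G x y
  apart ax ay = record { distinct = adj⇒≢ G xy ; cover = cover ; noCommonNeighbour = noCommon }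
    where
    a-isolated : ∀ {v} → adj G a v ≡ true → ⊥
    a-isolated av with neighbours av
    ... | inj₁ refl = true≢false av ax
    ... | inj₂ refl = true≢false av ay
    cover : ∀ {u v} → adj G u v ≡ true → u ∈[ x ∣ y ] ⊎ v ∈[ x ∣ y ]
    cover uv with edges uv
    ... | inj₁ refl = ⊥-elim (a-isolated uv)
    ... | inj₂ (inj₁ refl) = ⊥-elim (a-isolated (adj-sym G uv))
    ... | inj₂ (inj₂ same) = inj₁ ([ inj₁ ∘ proj₁ , inj₂ ∘ proj₁ ]′ same)
    noCommon : ∀ {z} → adj G z x ≡ true → adj G z y ≡ true → ⊥
    noCommon zx zy with edges zx
    ... | inj₁ refl = a-isolated zx
    ... | inj₂ (inj₁ x≡a) = a≢x (≡-sym x≡a)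
    ... | inj₂ (inj₂ (inj₁ (_ , x≡y))) = adj⇒≢ G xy x≡y
    ... | inj₂ (inj₂ (inj₂ (refl , _))) = adj⇒≢ G zy refl

hValue≡2-oneOutsideEdge : ∀ {n} {G : Graph n} {S a x y} →
  (∀ z → S z ≡ true → z ≡ a) → S a ≡ true → iNstar G S ≡ 0 →
  OutsideEdge G S x y → (∀ u v → OutsideEdge G S u v → SameEdge u v x y) → Shape G
hValue≡2-oneOutsideEdge {G = G} {S} {a} {x} {y} S⊆a Sa i≡0 out only with adj G a x in ax | adj G a y in ay
... | true | true = inj₁ (a , x , y , triangle ax ay)
  where open OneOutsideEdge S⊆a Sa i≡0 out only
... | true | false = inj₂ (x , a , pendant ax ay)
  where open OneOutsideEdge S⊆a Sa i≡0 out only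
... | false | true = inj₂ (y , a , pendant ay ax)
  where open OneOutsideEdge S⊆a Sa i≡0 (OutsideEdge-sym {G = G} {S} out) (λ u v → SameEdge-flip ∘ only u v)
... | false | false = inj₂ (x , y , apart ax ay)
  where open OneOutsideEdge S⊆a Sa i≡0 out only

hValue≡2⇒Shape : ∀ {n} (G : Graph n) {S} → (∃[ u ] ∃[ v ] adj G u v ≡ true) → NonEmpty S → hValue G S ≡ 2 → Shape G
hValue≡2⇒Shape G {S} edge (a , Sa) h≡2 with secondElement? S a
... | inj₁ (b , b≢a , Sb) = inj₂ (a , b , hValue≡2-twoElements Sa Sb (b≢a ∘ ≡-sym) h≡2)
... | inj₂ S⊆a with sum≡2-first≡1 (edgesOutside G S) (iNstar G S)
                      (trans (cong (λ c → c + edgesOutside G S + iNstar G S) (≡-sym count≡1)) h≡2)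
  where
  count≡1 : count S ≡ 1
  count≡1 = count≡length (Sa ∷ []) ([] ∷ []) (λ v Sv → here (S⊆a v Sv))
...   | inj₁ e≡0 = inj₂ (a , hValue≡2-noOutsideEdge edge S⊆a e≡0)
...   | inj₂ (e≡1 , i≡0) with edgesOutside≡1 G S e≡1
...     | x , y , out , only = hValue≡2-oneOutsideEdge S⊆a Sa i≡0 out only

-- Triangles up to isomorphism

Bool-≡ : ∀ {a b : Bool} → (a ≡ true ⇔ b ≡ true) → a ≡ b
Bool-≡ {true} a⇔b = ≡-sym (Equivalence.to a⇔b refl)
Bool-≡ {false} {true} a⇔b = Equivalence.from a⇔b refl
Bool-≡ {false} {false} _ = refl

∈₃-map : ∀ {n m} (f : Fin n → Fin m) {u x y z} → u ∈[ x ∣ y ∣ z ] → f u ∈[ f x ∣ f y ∣ f z ]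
∈₃-map f (inj₁ refl) = inj₁ refl
∈₃-map f (inj₂ (inj₁ refl)) = inj₂ (inj₁ refl)
∈₃-map f (inj₂ (inj₂ refl)) = inj₂ (inj₂ refl)

∈₃-unmap : ∀ {n m} {f : Fin n → Fin m} → Injective _≡_ _≡_ f →
  ∀ {u x y z} → f u ∈[ f x ∣ f y ∣ f z ] → u ∈[ x ∣ y ∣ z ]
∈₃-unmap f-inj (inj₁ e) = inj₁ (f-inj e)
∈₃-unmap f-inj (inj₂ (inj₁ e)) = inj₂ (inj₁ (f-inj e))
∈₃-unmap f-inj (inj₂ (inj₂ e)) = inj₂ (inj₂ (f-inj e))

module _ {n m} {A : Fin n → Fin n → Bool} {B : Fin m → Fin m → Bool} {f : Fin n → Fin m}
         (f-inj : Injective _≡_ _≡_ f) where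

  triangleCondition⇔ : ∀ {u v x y z} →
    (u ∈[ x ∣ y ∣ z ] × v ∈[ x ∣ y ∣ z ] × u ≢ v) ⇔
    (f u ∈[ f x ∣ f y ∣ f z ] × f v ∈[ f x ∣ f y ∣ f z ] × f u ≢ f v)
  triangleCondition⇔ = mk⇔
    (λ (u∈ , v∈ , u≢v) → ∈₃-map f u∈ , ∈₃-map f v∈ , λ fu≡fv → u≢v (f-inj fu≡fv))
    (λ (u∈ , v∈ , u≢v) → ∈₃-unmap f-inj u∈ , ∈₃-unmap f-inj v∈ , λ u≡v → u≢v (cong f u≡v))

  Triangle-pullback : (∀ u v → A u v ≡ B (f u) (f v)) → ∀ {x y z} →
    Triangle B (f x) (f y) (f z) → Triangle A x y z
  Triangle-pullback A≗B t = record
    { x≢y = x≢y ∘ cong f ; x≢z = x≢z ∘ cong f ; y≢z = y≢z ∘ cong f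
    ; adjacent⇔ = λ {u} {v} → ⇔-trans (≡⇔ (A≗B u v))
                    (⇔-trans adjacent⇔ (⇔-sym triangleCondition⇔)) }
    where
    open Triangle t
    ≡⇔ : ∀ {a b : Bool} → a ≡ b → (a ≡ true ⇔ b ≡ true)
    ≡⇔ refl = ⇔-refl

  Triangle-agree : ∀ {x y z} → Triangle A x y z → Triangle B (f x) (f y) (f z) → ∀ u v → A u v ≡ B (f u) (f v)
  Triangle-agree tA tB u v = Bool-≡ (⇔-trans (Triangle.adjacent⇔ tA)
    (⇔-trans triangleCondition⇔ (⇔-sym (Triangle.adjacent⇔ tB))))

Triangle-subst : ∀ {n} {A : Fin n → Fin n → Bool} {x y z x′ y′ z′} → x ≡ x′ → y ≡ y′ → z ≡ z′ →
  Triangle A x y z → Triangle A x′ y′ z′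
Triangle-subst refl refl refl t = t

transpose-hit : ∀ {n} (i j : Fin n) → PC.transpose i j i ≡ j
transpose-hit i j with i ≟ i
... | yes _ = refl
... | no i≢i = ⊥-elim (i≢i refl)

transpose-miss : ∀ {n} {i j k : Fin n} → k ≢ i → k ≢ j → PC.transpose i j k ≡ k
transpose-miss {i = i} {j} {k} k≢i k≢j with k ≟ i
... | yes k≡i = ⊥-elim (k≢i k≡i)
... | no _ with k ≟ j
...   | yes k≡j = ⊥-elim (k≢j k≡j)
...   | no _ = refl

permutation-injective : ∀ {n} (π : Permutation n n) → Injective _≡_ _≡_ (π ⟨$⟩ʳ_)
permutation-injective π = Injection.injective (↔⇒↣ π)

-- Each step transposes the next point into place, fixing the points already placed.
permutation-sending : ∀ {n} {x y z i j k : Fin n} → x ≢ y → x ≢ z → y ≢ z → i ≢ j → i ≢ k → j ≢ k →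
  Σ (Permutation n n) λ π → π ⟨$⟩ʳ x ≡ i × π ⟨$⟩ʳ y ≡ j × π ⟨$⟩ʳ z ≡ k
permutation-sending {x = x} {y} {z} {i} {j} {k} x≢y x≢z y≢z i≢j i≢k j≢k = π , πx , πy , πz
  where
  ρ₁ = transpose x i
  ρ₂ = ρ₁ ∘ₚ transpose (ρ₁ ⟨$⟩ʳ y) j
  π = ρ₂ ∘ₚ transpose (ρ₂ ⟨$⟩ʳ z) k
  ρ₁x : ρ₁ ⟨$⟩ʳ x ≡ i
  ρ₁x = transpose-hit x i
  ρ₂x : ρ₂ ⟨$⟩ʳ x ≡ i
  ρ₂x = trans (cong (PC.transpose (ρ₁ ⟨$⟩ʳ y) j) ρ₁x)
              (transpose-miss (λ i≡ → x≢y (permutation-injective ρ₁ (trans ρ₁x i≡))) i≢j)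
  ρ₂y : ρ₂ ⟨$⟩ʳ y ≡ j
  ρ₂y = transpose-hit (ρ₁ ⟨$⟩ʳ y) j
  πx : π ⟨$⟩ʳ x ≡ i
  πx = trans (cong (PC.transpose (ρ₂ ⟨$⟩ʳ z) k) ρ₂x)
             (transpose-miss (λ i≡ → x≢z (permutation-injective ρ₂ (trans ρ₂x i≡))) i≢k)
  πy : π ⟨$⟩ʳ y ≡ j
  πy = trans (cong (PC.transpose (ρ₂ ⟨$⟩ʳ z) k) ρ₂y)
             (transpose-miss (λ j≡ → y≢z (permutation-injective ρ₂ (trans ρ₂y j≡))) j≢k)
  πz : π ⟨$⟩ʳ z ≡ k
  πz = transpose-hit (ρ₂ ⟨$⟩ʳ z) k

module _ {m : ℕ} where
  private
    N = suc (suc (suc m))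

  0F 1F 2F : Fin N
  0F = fzero
  1F = fsuc fzero
  2F = fsuc (fsuc fzero)

  below3⇔ : ∀ (i : Fin N) → (toℕ i <ᵇ 3) ≡ true ⇔ i ∈[ 0F ∣ 1F ∣ 2F ]
  below3⇔ i = mk⇔ to from
    where
    to : ∀ {i : Fin N} → (toℕ i <ᵇ 3) ≡ true → i ∈[ 0F ∣ 1F ∣ 2F ]
    to {fzero} _ = inj₁ refl
    to {fsuc fzero} _ = inj₂ (inj₁ refl)
    to {fsuc (fsuc fzero)} _ = inj₂ (inj₂ refl)
    to {fsuc (fsuc (fsuc _))} ()
    from : ∀ {i : Fin N} → i ∈[ 0F ∣ 1F ∣ 2F ] → (toℕ i <ᵇ 3) ≡ true
    from (inj₁ refl) = refl
    from (inj₂ (inj₁ refl)) = refl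
    from (inj₂ (inj₂ refl)) = refl

  distinct⇔ : ∀ (u v : Fin N) → not ⌊ u ≟ v ⌋ ≡ true ⇔ u ≢ v
  distinct⇔ u v with u ≟ v
  ... | yes u≡v = mk⇔ (λ ()) (λ u≢v → ⊥-elim (u≢v u≡v))
  ... | no u≢v = mk⇔ (λ _ → u≢v) (λ _ → refl)

  K3∪Empty-Triangle : Triangle (K3∪Empty N) 0F 1F 2F
  K3∪Empty-Triangle = record
    { x≢y = λ () ; x≢z = λ () ; y≢z = λ ()
    ; adjacent⇔ = λ {u} {v} → mk⇔
        (λ e → let e′ = ∧-conicalʳ (toℕ u <ᵇ 3) _ e in
               Equivalence.to (below3⇔ u) (∧-conicalˡ _ _ e) ,
               Equivalence.to (below3⇔ v) (∧-conicalˡ (toℕ v <ᵇ 3) _ e′) ,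
               Equivalence.to (distinct⇔ u v) (∧-conicalʳ (toℕ v <ᵇ 3) _ e′))
        (λ (u∈ , v∈ , u≢v) → ∧-intro (Equivalence.from (below3⇔ u) u∈)
                               (∧-intro (Equivalence.from (below3⇔ v) v∈) (Equivalence.from (distinct⇔ u v) u≢v))) }

  Triangle⇒IsoAdj : ∀ {A : Fin N → Fin N → Bool} {x y z} → Triangle A x y z → IsoAdj A (K3∪Empty N)
  Triangle⇒IsoAdj t with permutation-sending {i = 0F} {1F} {2F} x≢y x≢z y≢z (λ ()) (λ ()) (λ ())
    where open Triangle t
  ... | π , πx , πy , πz =
    π , Triangle-agree (permutation-injective π) t (Triangle-subst (≡-sym πx) (≡-sym πy) (≡-sym πz) K3∪Empty-Triangle)

  IsoAdj⇒Triangle : ∀ {A : Fin N → Fin N → Bool} → IsoAdj A (K3∪Empty N) → ∃[ x ] ∃[ y ] ∃[ z ] Triangle A x y z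
  IsoAdj⇒Triangle (π , A≗K3) = π ⟨$⟩ˡ 0F , π ⟨$⟩ˡ 1F , π ⟨$⟩ˡ 2F ,
    Triangle-pullback (permutation-injective π) A≗K3
      (Triangle-subst (≡-sym (inverseʳ π)) (≡-sym (inverseʳ π)) (≡-sym (inverseʳ π)) K3∪Empty-Triangle)

-- Double stars

_++ʷ_ : ∀ {n} {G : Graph n} {i j u w v} → Walk G i u w → Walk G j w v → Walk G (i + j) u v
here ++ʷ q = q
step e p ++ʷ q = step e (p ++ʷ q)

DistLe-refl : ∀ {n} {G : Graph n} {k u} → DistLe G k u u
DistLe-refl = 0 , z≤n , here

DistLe-adj : ∀ {n} {G : Graph n} {u v} → adj G u v ≡ true → DistLe G 1 u v
DistLe-adj uv = 1 , ≤-refl , step uv here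

DistLe-trans : ∀ {n} {G : Graph n} {i j u w v} → DistLe G i u w → DistLe G j w v → DistLe G (i + j) u v
DistLe-trans (i′ , i′≤i , p) (j′ , j′≤j , q) = i′ + j′ , +-mono-≤ i′≤i j′≤j , p ++ʷ q

distinct⇒2≤ : ∀ {n} {a b : Fin n} → a ≢ b → 2 ≤ n
distinct⇒2≤ {suc zero} {fzero} {fzero} a≢b = ⊥-elim (a≢b refl)
distinct⇒2≤ {suc (suc n)} _ = s≤s (s≤s z≤n)

noThirdElement : ∀ {n} {a b x y z : Fin n} → x ∈[ a ∣ b ] → y ∈[ a ∣ b ] → z ∈[ a ∣ b ] →
  x ≢ y → x ≢ z → y ≢ z → ⊥
noThirdElement (inj₁ refl) (inj₁ refl) _ x≢y _ _ = x≢y refl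
noThirdElement (inj₂ refl) (inj₂ refl) _ x≢y _ _ = x≢y refl
noThirdElement (inj₁ refl) (inj₂ refl) (inj₁ refl) _ x≢z _ = x≢z refl
noThirdElement (inj₁ refl) (inj₂ refl) (inj₂ refl) _ _ y≢z = y≢z refl
noThirdElement (inj₂ refl) (inj₁ refl) (inj₁ refl) _ _ y≢z = y≢z refl
noThirdElement (inj₂ refl) (inj₁ refl) (inj₂ refl) _ x≢z _ = x≢z refl

-- The centres a, b are adjacent, and every other vertex x is a leaf attached to hub x.
module DoubleStar {m} {a b : Fin m} (a≢b : a ≢ b) (hub : Fin m → Fin m) (hub∈ : ∀ x → hub x ∈[ a ∣ b ]) where

  adjacency : Bool → Bool → Fin m → Fin m → Bool
  adjacency true  true  x y = not (does (x ≟ y))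
  adjacency true  false x y = does (hub y ≟ x)
  adjacency false true  x y = does (hub x ≟ y)
  adjacency false false _ _ = false

  Centre : Fin m → Set
  Centre x = x ∈[ a ∣ b ]

  centre? : ∀ x → Centre x ⊎ doubleton a b x ≡ false
  centre? x with doubleton a b x in e
  ... | true = inj₁ (doubleton-elim e)
  ... | false = inj₂ refl

  opaque
    adjD : Fin m → Fin m → Bool
    adjD x y = adjacency (doubleton a b x) (doubleton a b y) x y

    adjD-sym : ∀ x y → adjD x y ≡ adjD y x
    adjD-sym x y with doubleton a b x | doubleton a b y
    ... | true  | true  = cong not (≟-does-sym x y)
    ... | true  | false = refl
    ... | false | true  = refl
    ... | false | false = refl

    adjD-irrefl : ∀ x → adjD x x ≡ false
    adjD-irrefl x with doubleton a b x
    ... | true  = cong not (singleton-self x)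
    ... | false = refl

    centre-centre : ∀ {x y} → Centre x → Centre y → x ≢ y → adjD x y ≡ true
    centre-centre {x} {y} cx cy x≢y = subst₂ (λ p q → adjacency p q x y ≡ true)
      (≡-sym (doubleton-intro cx)) (≡-sym (doubleton-intro cy)) (cong not (singleton-other x≢y))

    hub-leaf : ∀ {x} → doubleton a b x ≡ false → adjD (hub x) x ≡ true
    hub-leaf {x} leaf = subst₂ (λ p q → adjacency p q (hub x) x ≡ true)
      (≡-sym (doubleton-intro (hub∈ x))) (≡-sym leaf) (singleton-self (hub x))

    leaf-adj : ∀ {x y} → doubleton a b x ≡ false → adjD x y ≡ true → y ≡ hub x
    leaf-adj {x} {y} leaf xy = fromLeaf (doubleton a b y) (subst (λ p → adjacency p (doubleton a b y) x y ≡ true) leaf xy)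
      where
      fromLeaf : ∀ q → adjacency false q x y ≡ true → y ≡ hub x
      fromLeaf true e = ≡-sym (singleton-elim e)

  graph : Graph m
  graph = record { adj = adjD ; sym = adjD-sym ; irrefl = adjD-irrefl }

  twoNeighbours⇒Centre : ∀ {x p q} → adjD x p ≡ true → adjD x q ≡ true → p ≢ q → Centre x
  twoNeighbours⇒Centre {x} xp xq p≢q with centre? x
  ... | inj₁ cx = cx
  ... | inj₂ leaf = ⊥-elim (p≢q (trans (leaf-adj leaf xp) (≡-sym (leaf-adj leaf xq))))

  -- On a cycle every vertex has two distinct neighbours, so the first three cycle vertices would be three distinct centres.
  acyclic : ¬ HasCycle graph
  acyclic (k , c , c-inj , consecutive , closing) =
    noThirdElement centre₀ centre₁ centreₗ (λ e → 0≢1 (c-inj e)) (λ e → 0≢ₗ (c-inj e)) (λ e → 1≢ₗ (c-inj e))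
    where
    0≢1 : fzero ≢ Data.Fin.suc {suc (suc k)} fzero
    0≢1 ()
    0≢ₗ : fzero ≢ fromℕ (suc (suc k))
    0≢ₗ ()
    1≢ₗ : fsuc fzero ≢ fromℕ (suc (suc k))
    1≢ₗ ()
    centre₀ : Centre (c fzero)
    centre₀ = twoNeighbours⇒Centre (consecutive fzero) (adj-sym graph closing) (λ e → 1≢ₗ (c-inj e))
    centre₁ : Centre (c (fsuc fzero))
    centre₁ = twoNeighbours⇒Centre (adj-sym graph (consecutive fzero)) (consecutive (fsuc fzero)) (λ e → 0≢2 (c-inj e))
      where
      0≢2 : fzero ≢ Data.Fin.suc {suc (suc k)} (fsuc fzero)
      0≢2 ()
    centreₗ : Centre (c (fromℕ (suc (suc k))))
    centreₗ = twoNeighbours⇒Centre (adj-sym graph (consecutive (fromℕ (suc k)))) closing (λ e → ₗ₋₁≢0 (c-inj e))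
      where
      ₗ₋₁≢0 : inject₁ (fromℕ (suc k)) ≢ fzero
      ₗ₋₁≢0 ()

  nearCentre : ∀ x → ∃[ c ] Centre c × DistLe graph 1 x c × DistLe graph 1 c x
  nearCentre x with centre? x
  ... | inj₁ cx = x , cx , DistLe-refl , DistLe-refl
  ... | inj₂ leaf = hub x , hub∈ x , DistLe-adj (adj-sym graph (hub-leaf leaf)) , DistLe-adj (hub-leaf leaf)

  centresNear : ∀ {c c′} → Centre c → Centre c′ → DistLe graph 1 c c′
  centresNear {c} {c′} cc cc′ with c ≟ c′
  ... | yes refl = DistLe-refl
  ... | no c≢c′ = DistLe-adj (centre-centre cc cc′ c≢c′)

  diameter≤3 : ∀ x y → DistLe graph 3 x y
  diameter≤3 x y with nearCentre x | nearCentre y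
  ... | c , cc , x→c , _ | c′ , cc′ , _ , c′→y = DistLe-trans x→c (DistLe-trans (centresNear cc cc′) c′→y)

  leavesApart : ∀ {l l′} → doubleton a b l ≡ false → doubleton a b l′ ≡ false → hub l ≡ a → hub l′ ≡ b →
    ¬ DistLe graph 2 l l′
  leavesApart leaf leaf′ hl hl′ (_ , _ , here) = a≢b (trans (≡-sym hl) hl′)
  leavesApart leaf leaf′ hl hl′ (_ , _ , step ll′ here) =
    true≢false (doubleton-intro (inj₁ (trans (leaf-adj leaf ll′) hl))) leaf′
  leavesApart leaf leaf′ hl hl′ (_ , _ , step lw (step wl′ here)) =
    a≢b (trans (≡-sym (trans (leaf-adj leaf lw) hl)) (trans (leaf-adj leaf′ (adj-sym graph wl′)) hl′))
  leavesApart leaf leaf′ hl hl′ (_ , s≤s (s≤s ()) , step _ (step _ (step _ _)))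

  isDoubleStar : 4 ≤ m → ∀ {l l′} → doubleton a b l ≡ false → doubleton a b l′ ≡ false → hub l ≡ a → hub l′ ≡ b →
    IsDoubleStar graph
  isDoubleStar 4≤m {l} {l′} leaf leaf′ hl hl′ =
    4≤m , ((λ x y → let (k , _ , w) = diameter≤3 x y in k , w) , acyclic) ,
    diameter≤3 , l , l′ , leavesApart leaf leaf′ hl hl′

∈[∣]? : ∀ {n} (v a b : Fin n) → v ∈[ a ∣ b ] ⊎ (v ≢ a × v ≢ b)
∈[∣]? v a b with v ≟ a | v ≟ b
... | yes v≡a | _ = inj₁ (inj₁ v≡a)
... | no _ | yes v≡b = inj₁ (inj₂ v≡b)
... | no v≢a | no v≢b = inj₂ (v≢a , v≢b)

doubleton-out : ∀ {n} {a b v : Fin n} → v ≢ a → v ≢ b → doubleton a b v ≡ false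
doubleton-out v≢a v≢b = cong₂ _∨_ (singleton-other v≢a) (singleton-other v≢b)

-- The two new vertices 0 and 1 are leaves at the two centres, which makes the diameter exactly 3.
Centres⇒SubgraphOfDoubleStar : ∀ {n} {G : Graph n} {a b} → Centres G a b → SubgraphOfDoubleStar G
Centres⇒SubgraphOfDoubleStar {n} {G} {a} {b} c =
  suc (suc n) , graph , isDoubleStar (s≤s (s≤s (distinct⇒2≤ distinct))) {fzero} {fsuc fzero} refl refl refl refl ,
  shift , shift-injective , embed
  where
  open Centres c
  shift : Fin n → Fin (suc (suc n))
  shift u = fsuc (fsuc u)
  shift-injective : Injective _≡_ _≡_ shift
  shift-injective = suc-injective ∘ suc-injective
  hub : Fin (suc (suc n)) → Fin (suc (suc n))
  hub fzero = shift a
  hub (fsuc fzero) = shift b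
  hub (fsuc (fsuc u)) = if adj G a u then shift a else shift b
  hub∈ : ∀ x → hub x ∈[ shift a ∣ shift b ]
  hub∈ fzero = inj₁ refl
  hub∈ (fsuc fzero) = inj₂ refl
  hub∈ (fsuc (fsuc u)) with adj G a u
  ... | true = inj₁ refl
  ... | false = inj₂ refl
  open DoubleStar (distinct ∘ shift-injective) hub hub∈
  fromCentre : ∀ {u v} → u ∈[ a ∣ b ] → adj G u v ≡ true → adjD (shift u) (shift v) ≡ true
  fromCentre {u} {v} u∈ uv with ∈[∣]? v a b
  ... | inj₁ v∈ = centre-centre (shift∈ u∈) (shift∈ v∈) (adj⇒≢ G uv ∘ shift-injective)
    where
    shift∈ : ∀ {w} → w ∈[ a ∣ b ] → shift w ∈[ shift a ∣ shift b ]
    shift∈ = [ inj₁ ∘ cong shift , inj₂ ∘ cong shift ]′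
  ... | inj₂ (v≢a , v≢b) = subst (λ w → adjD w (shift v) ≡ true) (hubOf u∈) (hub-leaf (doubleton-out v≢a v≢b))
    where
    hubOf : u ∈[ a ∣ b ] → hub (shift v) ≡ shift u
    hubOf (inj₁ refl) rewrite uv = refl
    hubOf (inj₂ refl) with adj G a v in av
    ... | true = ⊥-elim (noCommonNeighbour (adj-sym G av) (adj-sym G uv))
    ... | false = refl
  embed : ∀ u v → adj G u v ≡ true → adjD (shift u) (shift v) ≡ true
  embed u v uv = [ (λ u∈ → fromCentre u∈ uv) , (λ v∈ → adj-sym graph (fromCentre v∈ (adj-sym G uv))) ]′ (cover uv)

linked-prefix : ∀ {A : Set} {R : A → A → Set} (xs : List A) {ys} → Linked R (xs ++ ys) → Linked R xs
linked-prefix [] _ = []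
linked-prefix (x ∷ []) _ = [-]
linked-prefix (x ∷ y ∷ xs) (Rxy ∷ l) = Rxy ∷ linked-prefix (y ∷ xs) l

linked-ʳ++ : ∀ {A : Set} {R : A → A → Set} → (∀ {x y} → R x y → R y x) → ∀ xs {ys} →
  Linked R xs → Linked R ys → MaybeConnected R (List.head xs) (List.head ys) → Linked R (xs ʳ++ ys)
linked-ʳ++ R-sym [] _ lys _ = lys
linked-ʳ++ R-sym (x ∷ xs) lxs lys junction =
  linked-ʳ++ R-sym xs (Linked.tail lxs) (junction ∷′ lys) (MaybeConnected-sym R-sym (Linked.head′ lxs))

lookup-injective : ∀ {A : Set} {xs : List A} → Unique xs → Injective _≡_ _≡_ (List.lookup xs)
lookup-injective {xs = x ∷ xs} _ {fzero} {fzero} _ = refl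
lookup-injective {xs = x ∷ xs} (x≢xs ∷ _) {fzero} {fsuc j} e = ⊥-elim (All.lookup x≢xs (∈-lookup j) e)
lookup-injective {xs = x ∷ xs} (x≢xs ∷ _) {fsuc i} {fzero} e = ⊥-elim (All.lookup x≢xs (∈-lookup i) (≡-sym e))
lookup-injective {xs = x ∷ xs} (_ ∷ unique) {fsuc i} {fsuc j} e = cong fsuc (lookup-injective unique e)

unique-split : ∀ {A : Set} (pre : List A) {x post} → Unique (pre ++ x ∷ post) → Unique (x ∷ pre)
unique-split [] _ = [] ∷ []
unique-split (y ∷ pre) (y≢rest ∷ unique) with unique-split pre unique
... | x≢pre ∷ unique-pre =
  ((λ x≡y → All.lookup y≢rest (∈-++⁺ʳ pre (here refl)) (≡-sym x≡y)) ∷ x≢pre) ∷ ++⁻ˡ pre y≢rest ∷ unique-pre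

ʳ++-unique-suffix : ∀ {A : Set} (xs : List A) {ys} → Unique (xs ʳ++ ys) → Unique ys
ʳ++-unique-suffix [] unique = unique
ʳ++-unique-suffix (x ∷ xs) unique with ʳ++-unique-suffix xs unique
... | _ ∷ unique-ys = unique-ys

ʳ++-¬unique : ∀ {A : Set} (xs : List A) {ys t} → t ∈ xs → t ∈ ys → ¬ Unique (xs ʳ++ ys)
ʳ++-¬unique (x ∷ xs) (here refl) t∈ys unique with ʳ++-unique-suffix xs unique
... | x≢ys ∷ _ = All.lookup x≢ys t∈ys refl
ʳ++-¬unique (x ∷ xs) (there t∈xs) t∈ys unique = ʳ++-¬unique xs t∈xs (there t∈ys) unique

last-∈ : ∀ {A : Set} (xs : List A) {t} → List.last xs ≡ just t → t ∈ xs
last-∈ (x ∷ []) refl = here refl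
last-∈ (x ∷ y ∷ xs) e = there (last-∈ (y ∷ xs) e)

module NonBacktracking {m} (D : Graph m) where
  open import Data.List.Membership.DecPropositional (_≟_ {m}) using (_∈?_)

  Adj : Fin m → Fin m → Set
  Adj x y = adj D x y ≡ true

  data NoBacktrack : List (Fin m) → Set where
    []    : NoBacktrack []
    [-]   : ∀ {x} → NoBacktrack (x ∷ [])
    [-,-] : ∀ {x y} → NoBacktrack (x ∷ y ∷ [])
    _∷_   : ∀ {x y z l} → x ≢ z → NoBacktrack (y ∷ z ∷ l) → NoBacktrack (x ∷ y ∷ z ∷ l)

  noBacktrack-tail : ∀ {x l} → NoBacktrack (x ∷ l) → NoBacktrack l
  noBacktrack-tail [-] = []
  noBacktrack-tail [-,-] = [-]
  noBacktrack-tail (_ ∷ nb) = nb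

  noBacktrack-prefix : ∀ xs {ys} → NoBacktrack (xs ++ ys) → NoBacktrack xs
  noBacktrack-prefix [] _ = []
  noBacktrack-prefix (x ∷ []) _ = [-]
  noBacktrack-prefix (x ∷ y ∷ []) _ = [-,-]
  noBacktrack-prefix (x ∷ y ∷ z ∷ xs) (x≢z ∷ nb) = x≢z ∷ noBacktrack-prefix (y ∷ z ∷ xs) nb

  -- Reversing xs onto ys creates two new consecutive triples, around the junction between head xs and head ys.
  noBacktrack-ʳ++ : ∀ xs {ys} → NoBacktrack xs → NoBacktrack ys →
    MaybeConnected _≢_ (List.head (List.drop 1 xs)) (List.head ys) →
    MaybeConnected _≢_ (List.head xs) (List.head (List.drop 1 ys)) → NoBacktrack (xs ʳ++ ys)
  noBacktrack-ʳ++ [] _ nb-ys _ _ = nb-ys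
  noBacktrack-ʳ++ (x ∷ xs) {ys} nb-xs nb-ys second≢head head≢second =
    noBacktrack-ʳ++ xs (noBacktrack-tail nb-xs) (cons ys nb-ys head≢second) (turn xs nb-xs) second≢head
    where
    cons : ∀ ys → NoBacktrack ys → MaybeConnected _≢_ (just x) (List.head (List.drop 1 ys)) → NoBacktrack (x ∷ ys)
    cons [] _ _ = [-]
    cons (y ∷ []) _ _ = [-,-]
    cons (y ∷ z ∷ ys) nb (just x≢z) = x≢z ∷ nb
    turn : ∀ xs → NoBacktrack (x ∷ xs) → MaybeConnected _≢_ (List.head (List.drop 1 xs)) (just x)
    turn [] _ = nothing-just
    turn (y ∷ []) _ = nothing-just
    turn (y ∷ z ∷ xs) (x≢z ∷ _) = just (x≢z ∘ ≡-sym)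

  record NBWalk (s t : Fin m) (l : List (Fin m)) : Set where
    field
      linked      : Linked Adj (s ∷ l)
      noBacktrack : NoBacktrack (s ∷ l)
      endsAt      : List.last (s ∷ l) ≡ just t

  NBWalk-tail : ∀ {s t x l} → NBWalk s t (x ∷ l) → NBWalk x t l
  NBWalk-tail w = record
    { linked = Linked.tail linked ; noBacktrack = noBacktrack-tail noBacktrack ; endsAt = endsAt }
    where open NBWalk w

  linked-lookup : ∀ {x y} l → Linked Adj (x ∷ y ∷ l) → ∀ (i : Fin (suc (length l))) →
    Adj (List.lookup (x ∷ y ∷ l) (inject₁ i)) (List.lookup (x ∷ y ∷ l) (fsuc i))
  linked-lookup l (xy ∷ _) fzero = xy
  linked-lookup (z ∷ l) (_ ∷ linked) (fsuc i) = linked-lookup l linked i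

  linked-last : ∀ {x y} l → Linked Adj (x ∷ l List.∷ʳ y) → Adj (List.lookup (x ∷ l) (fromℕ (length l))) y
  linked-last [] (xy ∷ _) = xy
  linked-last (z ∷ l) (_ ∷ linked) = linked-last l linked

  loop⇒cycle : ∀ x pre → Unique (x ∷ pre) →
    Linked Adj (x ∷ pre List.∷ʳ x) → NoBacktrack (x ∷ pre List.∷ʳ x) → HasCycle D
  loop⇒cycle x [] _ (xx ∷ _) _ = ⊥-elim (adj⇒≢ D xx refl)
  loop⇒cycle x (y ∷ []) _ _ (x≢x ∷ _) = ⊥-elim (x≢x refl)
  loop⇒cycle x (y ∷ z ∷ r) unique linked _ =
    length r , List.lookup (x ∷ y ∷ z ∷ r) , lookup-injective unique ,
    linked-lookup (z ∷ r) (linked-prefix (x ∷ y ∷ z ∷ r) linked) , linked-last (y ∷ z ∷ r) linked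

  -- The first repeated vertex closes a loop on which all other vertices are distinct.
  unique⊎cycle : ∀ l → Linked Adj l → NoBacktrack l → Unique l ⊎ HasCycle D
  unique⊎cycle [] _ _ = inj₁ []
  unique⊎cycle (x ∷ l) linked nb with unique⊎cycle l (Linked.tail linked) (noBacktrack-tail nb)
  ... | inj₂ cycle = inj₂ cycle
  ... | inj₁ unique with x ∈? l
  ...   | no x∉l = inj₁ (¬Any⇒All¬ l x∉l ∷ unique)
  ...   | yes x∈l with ∈-∃++ x∈l
  ...     | pre , post , refl = inj₂ (loop⇒cycle x pre (unique-split pre unique)
              (linked-prefix (x ∷ pre List.∷ʳ x) (subst (Linked Adj) (split-eq pre) linked))
              (noBacktrack-prefix (x ∷ pre List.∷ʳ x) (subst NoBacktrack (split-eq pre) nb)))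
    where
    split-eq : ∀ pre → x ∷ pre ++ x ∷ post ≡ (x ∷ pre List.∷ʳ x) ++ post
    split-eq pre = cong (x ∷_) (≡-sym (++-assoc pre (x ∷ []) post))

  shorten : ∀ {j u v} → Walk D j u v → ∃[ l ] NBWalk u v l × length l ≤ j
  shorten here = [] , record { linked = [-] ; noBacktrack = [-] ; endsAt = refl } , z≤n
  shorten {u = u} (step {w = w} uw W) with shorten W
  ... | [] , record { endsAt = refl } , _ = w ∷ [] , record { linked = uw ∷ [-] ; noBacktrack = [-,-] ; endsAt = refl } , s≤s z≤n
  ... | z ∷ l , W′ , len with z ≟ u
  ...   | yes refl = l , NBWalk-tail W′ , ≤-trans (n≤1+n _) (≤-trans len (n≤1+n _))
  ...   | no z≢u = w ∷ z ∷ l ,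
    record { linked = uw ∷ linked ; noBacktrack = (z≢u ∘ ≡-sym) ∷ noBacktrack ; endsAt = endsAt } , s≤s len
    where open NBWalk W′

  module _ (acyclic : ¬ HasCycle D) where

    nonBacktracking⇒unique : ∀ {l} → Linked Adj l → NoBacktrack l → Unique l
    nonBacktracking⇒unique {l} linked nb with unique⊎cycle l linked nb
    ... | inj₁ unique = unique
    ... | inj₂ cycle = ⊥-elim (acyclic cycle)

    noClosedNBWalk : ∀ {s y q} → NBWalk s s (y ∷ q) → ⊥
    noClosedNBWalk {q = q} w with nonBacktracking⇒unique (NBWalk.linked w) (NBWalk.noBacktrack w)
    ... | s≢rest ∷ _ = All.lookup s≢rest (last-∈ (_ ∷ q) (NBWalk.endsAt w)) refl

    -- Two walks leaving s in different directions combine, through s, into a non-backtracking walk visiting t twice.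
    NBWalk-length-unique : ∀ {s t} l₁ l₂ → NBWalk s t l₁ → NBWalk s t l₂ → length l₁ ≡ length l₂
    NBWalk-length-unique [] [] _ _ = refl
    NBWalk-length-unique [] (y ∷ q) record { endsAt = refl } w₂ = ⊥-elim (noClosedNBWalk w₂)
    NBWalk-length-unique (x ∷ p) [] w₁ record { endsAt = refl } = ⊥-elim (noClosedNBWalk w₁)
    NBWalk-length-unique {s} (x ∷ p) (y ∷ q) w₁ w₂ with x ≟ y
    ... | yes refl = cong suc (NBWalk-length-unique p q (NBWalk-tail w₁) (NBWalk-tail w₂))
    ... | no x≢y = ⊥-elim (ʳ++-¬unique (s ∷ x ∷ p) (last-∈ (s ∷ x ∷ p) W₁.endsAt) (last-∈ (y ∷ q) W₂.endsAt)
          (nonBacktracking⇒unique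
            (linked-ʳ++ (adj-sym D) (s ∷ x ∷ p) W₁.linked (Linked.tail W₂.linked) (just (Linked.head W₂.linked)))
            (noBacktrack-ʳ++ (s ∷ x ∷ p) W₁.noBacktrack (noBacktrack-tail W₂.noBacktrack) (just x≢y)
              (secondStep q W₂.noBacktrack))))
      where
      module W₁ = NBWalk w₁
      module W₂ = NBWalk w₂
      secondStep : ∀ q → NoBacktrack (s ∷ y ∷ q) → MaybeConnected _≢_ (just s) (List.head q)
      secondStep [] _ = just-nothing
      secondStep (z ∷ q) (s≢z ∷ _) = just s≢z

    closedWalk⊥ : ∀ {x} l → Linked Adj (x ∷ l List.∷ʳ x) → NoBacktrack (x ∷ l List.∷ʳ x) → ⊥
    closedWalk⊥ {x} l linked nb with nonBacktracking⇒unique linked nb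
    ... | x≢rest ∷ _ = All.lookup x≢rest (∈-++⁺ʳ l (here refl)) refl

  NBWalk-turn : ∀ {s t x y l} → NBWalk s t (x ∷ y ∷ l) → s ≢ y
  NBWalk-turn record { noBacktrack = s≢y ∷ _ } = s≢y

  NBWalk-cons : ∀ {x s t l} → Adj x s → MaybeConnected _≢_ (just x) (List.head l) → NBWalk s t l → NBWalk x t (s ∷ l)
  NBWalk-cons {l = l} xs x≢next w = record
    { linked = xs ∷ linked ; noBacktrack = cons l x≢next noBacktrack ; endsAt = endsAt }
    where
    open NBWalk w
    cons : ∀ {x s} l → MaybeConnected _≢_ (just x) (List.head l) → NoBacktrack (s ∷ l) → NoBacktrack (x ∷ s ∷ l)
    cons [] _ _ = [-,-]
    cons (z ∷ l) (just x≢z) nb = x≢z ∷ nb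

threeStepPath : ∀ {m} {D : Graph m} {u v} → DistLe D 3 u v → ¬ DistLe D 2 u v →
  ∃[ a ] ∃[ b ] adj D u a ≡ true × adj D a b ≡ true × adj D b v ≡ true
threeStepPath (_ , _ , here) far = ⊥-elim (far (0 , z≤n , here))
threeStepPath (_ , _ , step ua here) far = ⊥-elim (far (1 , s≤s z≤n , step ua here))
threeStepPath (_ , _ , step ua (step ab here)) far = ⊥-elim (far (2 , ≤-refl , step ua (step ab here)))
threeStepPath (_ , _ , step ua (step ab (step bv here))) _ = _ , _ , ua , ab , bv
threeStepPath (_ , s≤s (s≤s (s≤s ())) , step _ (step _ (step _ (step _ _)))) _

module DoubleStarCentres {m} {D : Graph m} (acyclic : ¬ HasCycle D) (diameter≤3 : ∀ x y → DistLe D 3 x y)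
                         {u v a b} (ua : adj D u a ≡ true) (ab : adj D a b ≡ true) (bv : adj D b v ≡ true)
                         (far : ¬ DistLe D 2 u v) where
  open NonBacktracking D

  NBWalk-length≤3 : ∀ {x y} l → NBWalk x y l → length l ≤ 3
  NBWalk-length≤3 {x} {y} l w with shorten (proj₂ (proj₂ (diameter≤3 x y)))
  ... | l′ , w′ , l′≤ =
    subst (_≤ 3) (NBWalk-length-unique acyclic l′ l w′ w) (≤-trans l′≤ (proj₁ (proj₂ (diameter≤3 x y))))

  u≢b : u ≢ b
  u≢b refl = far (1 , s≤s z≤n , step bv here)

  v≢a : v ≢ a
  v≢a refl = far (1 , s≤s z≤n , step ua here)

  Near : Fin m → Set
  Near z = z ∈[ a ∣ b ] ⊎ adj D a z ≡ true ⊎ adj D b z ≡ true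

  -- A non-backtracking walk from a to any other vertex extends, through u or v, to one of length > 3.
  near : ∀ z → Near z
  near z with shorten (proj₂ (proj₂ (diameter≤3 a z)))
  ... | [] , record { endsAt = refl } , _ = inj₁ (inj₁ refl)
  ... | q ∷ [] , record { linked = aq ∷ _ ; endsAt = refl } , _ = inj₂ (inj₁ aq)
  ... | q ∷ q′ ∷ l , w , _ with q ≟ b
  ...   | yes refl = viaB q′ l (NBWalk-turn w) (NBWalk-tail w)
    where
    viaB : ∀ q′ l → a ≢ q′ → NBWalk b z (q′ ∷ l) → Near z
    viaB q′ [] _ record { linked = bq′ ∷ _ ; endsAt = refl } = inj₂ (inj₂ bq′)
    viaB q′ (r ∷ l) a≢q′ w′
      with NBWalk-length≤3 (a ∷ b ∷ q′ ∷ r ∷ l) (NBWalk-cons ua (just u≢b) (NBWalk-cons ab (just a≢q′) w′))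
    ... | s≤s (s≤s (s≤s ()))
  ...   | no q≢b with NBWalk-length≤3 (b ∷ a ∷ q ∷ q′ ∷ l)
                        (NBWalk-cons (adj-sym D bv) (just v≢a) (NBWalk-cons (adj-sym D ab) (just (q≢b ∘ ≡-sym)) w))
  ...     | s≤s (s≤s (s≤s ()))

  noCommonNeighbour : ∀ {x} → adj D x a ≡ true → adj D x b ≡ true → ⊥
  noCommonNeighbour xa xb =
    closedWalk⊥ acyclic (_ ∷ b ∷ []) (adj-sym D xa ∷ xb ∷ adj-sym D ab ∷ [-]) (adj⇒≢ D ab ∷ adj⇒≢ D xa ∷ [-,-])

  cover : ∀ {x y} → adj D x y ≡ true → x ∈[ a ∣ b ] ⊎ y ∈[ a ∣ b ]
  cover {x} {y} xy with ∈[∣]? x a b | ∈[∣]? y a b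
  ... | inj₁ x∈ | _ = inj₁ x∈
  ... | inj₂ _ | inj₁ y∈ = inj₂ y∈
  ... | inj₂ (x≢a , x≢b) | inj₂ (y≢a , y≢b) = ⊥-elim (neighbours (near x) (near y))
    where
    neighbours : Near x → Near y → ⊥
    neighbours (inj₁ x∈) _ = [ x≢a , x≢b ]′ x∈
    neighbours _ (inj₁ y∈) = [ y≢a , y≢b ]′ y∈
    neighbours (inj₂ (inj₁ ax)) (inj₂ (inj₁ ay)) =
      closedWalk⊥ acyclic (x ∷ y ∷ []) (ax ∷ xy ∷ adj-sym D ay ∷ [-]) ((y≢a ∘ ≡-sym) ∷ x≢a ∷ [-,-])
    neighbours (inj₂ (inj₁ ax)) (inj₂ (inj₂ by)) =
      closedWalk⊥ acyclic (x ∷ y ∷ b ∷ []) (ax ∷ xy ∷ adj-sym D by ∷ adj-sym D ab ∷ [-])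
        ((y≢a ∘ ≡-sym) ∷ x≢b ∷ y≢a ∷ [-,-])
    neighbours (inj₂ (inj₂ bx)) (inj₂ (inj₁ ay)) =
      closedWalk⊥ acyclic (x ∷ y ∷ a ∷ []) (bx ∷ xy ∷ adj-sym D ay ∷ ab ∷ [-])
        ((y≢b ∘ ≡-sym) ∷ x≢a ∷ y≢b ∷ [-,-])
    neighbours (inj₂ (inj₂ bx)) (inj₂ (inj₂ by)) =
      closedWalk⊥ acyclic (x ∷ y ∷ []) (bx ∷ xy ∷ adj-sym D by ∷ [-]) ((y≢b ∘ ≡-sym) ∷ x≢b ∷ [-,-])

  centres : Centres D a b
  centres = record { distinct = adj⇒≢ D ab ; cover = cover ; noCommonNeighbour = noCommonNeighbour }

DoubleStar⇒Centres : ∀ {m} {D : Graph m} → IsDoubleStar D → ∃[ a ] ∃[ b ] Centres D a b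
DoubleStar⇒Centres (_ , (_ , acyclic) , diameter≤3 , u , v , far) with threeStepPath (diameter≤3 u v) far
... | a , b , ua , ab , bv = a , b , DoubleStarCentres.centres acyclic diameter≤3 ua ab bv far

anotherVertex : ∀ {n} → 2 ≤ n → ∀ (p : Fin n) → ∃[ q ] q ≢ p
anotherVertex (s≤s (s≤s _)) fzero = fsuc fzero , λ ()
anotherVertex (s≤s (s≤s _)) (fsuc p) = fzero , λ ()

Centres-swap : ∀ {n} {G : Graph n} {a b} → Centres G a b → Centres G b a
Centres-swap {G = G} c = record
  { distinct = distinct ∘ ≡-sym
  ; cover = λ uv → Data.Sum.map Data.Sum.swap Data.Sum.swap (cover uv)
  ; noCommonNeighbour = λ xb xa → noCommonNeighbour xa xb }
  where open Centres c

module _ {n m} {G : Graph n} {H : Graph m} (f : Fin n → Fin m) (f-injective : Injective _≡_ _≡_ f)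
         (embed : ∀ u v → adj G u v ≡ true → adj H (f u) (f v) ≡ true) where

  onlyPreimage : ∀ {a b p} → Centres H a b → f p ≡ a → ¬ (∃[ q ] f q ≡ b) →
    ∀ {u v} → adj G u v ≡ true → u ≡ p ⊎ v ≡ p
  onlyPreimage {a} {b} {p} c fp no-b uv = Data.Sum.map toP toP (Centres.cover c (embed _ _ uv))
    where
    toP : ∀ {x} → f x ∈[ a ∣ b ] → x ≡ p
    toP (inj₁ fx≡a) = f-injective (trans fx≡a (≡-sym fp))
    toP (inj₂ fx≡b) = ⊥-elim (no-b (_ , fx≡b))

  Centres-pullback : ∀ {a b} → (∃[ u ] ∃[ v ] adj G u v ≡ true) → Centres H a b → ∃[ p ] ∃[ q ] Centres G p q
  Centres-pullback {a} {b} (u₀ , v₀ , u₀v₀) c with any? (λ p → f p ≟ a) | any? (λ q → f q ≟ b)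
  ... | yes (p , fp) | yes (q , fq) = p , q , record
    { distinct = λ p≡q → distinct (trans (≡-sym fp) (trans (cong f p≡q) fq))
    ; cover = λ uv → Data.Sum.map preimage preimage (cover (embed _ _ uv))
    ; noCommonNeighbour = λ xp xq → noCommonNeighbour (subst (λ w → adj H _ w ≡ true) fp (embed _ _ xp))
                                                      (subst (λ w → adj H _ w ≡ true) fq (embed _ _ xq)) }
    where
    open Centres c
    preimage : ∀ {x} → f x ∈[ a ∣ b ] → x ∈[ p ∣ q ]
    preimage = Data.Sum.map (λ e → f-injective (trans e (≡-sym fp))) (λ e → f-injective (trans e (≡-sym fq)))
  ... | yes (p , fp) | no no-b = p , _ , star⇒Centres (proj₂ (anotherVertex 2≤n p)) (onlyPreimage c fp no-b)
    where 2≤n = distinct⇒2≤ (adj⇒≢ G u₀v₀)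
  ... | no no-a | yes (q , fq) = q , _ , star⇒Centres (proj₂ (anotherVertex 2≤n q)) (onlyPreimage (Centres-swap c) fq no-a)
    where 2≤n = distinct⇒2≤ (adj⇒≢ G u₀v₀)
  ... | no no-a | no no-b = ⊥-elim ([ noPreimage , noPreimage ]′ (Centres.cover c (embed _ _ u₀v₀)))
    where
    noPreimage : ∀ {x} → f x ∈[ a ∣ b ] → ⊥
    noPreimage = [ (λ fx≡a → no-a (_ , fx≡a)) , (λ fx≡b → no-b (_ , fx≡b)) ]′

SubgraphOfDoubleStar⇒Centres : ∀ {n} {G : Graph n} → (∃[ u ] ∃[ v ] adj G u v ≡ true) →
  SubgraphOfDoubleStar G → ∃[ p ] ∃[ q ] Centres G p q
SubgraphOfDoubleStar⇒Centres edge (_ , D , doubleStar , f , f-injective , embed) with DoubleStar⇒Centres doubleStar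
... | a , b , c = Centres-pullback f f-injective embed edge c

theorem2p2 : ∀ (n : ℕ) (G : Graph n) → 3 ≤ n → (∃[ u ] ∃[ v ] adj G u v ≡ true) →
    (HEq G 2 ⇔ (IsoAdj (adj G) (K3∪Empty n) ⊎ SubgraphOfDoubleStar G))
theorem2p2 (suc (suc (suc m))) G (s≤s (s≤s (s≤s _))) edge = mk⇔ to from
  where
  to : HEq G 2 → IsoAdj (adj G) (K3∪Empty _) ⊎ SubgraphOfDoubleStar G
  to ((S , nonEmpty , h≡2) , _) with hValue≡2⇒Shape G edge nonEmpty h≡2
  ... | inj₁ (_ , _ , _ , triangle) = inj₁ (Triangle⇒IsoAdj triangle)
  ... | inj₂ (_ , _ , centres) = inj₂ (Centres⇒SubgraphOfDoubleStar centres)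
  from : IsoAdj (adj G) (K3∪Empty _) ⊎ SubgraphOfDoubleStar G → HEq G 2
  from (inj₁ iso) with IsoAdj⇒Triangle iso
  ... | x , _ , _ , triangle = (singleton x , (x , singleton-self x) , hValue-Triangle G triangle) , hValue≥2 G edge
  from (inj₂ subgraph) with SubgraphOfDoubleStar⇒Centres edge subgraph
  ... | a , b , centres = (doubleton a b , (a , doubleton-intro {a = a} {b} (inj₁ refl)) , hValue-Centres G centres) , hValue≥2 G edge
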